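{- Let $A$ be a symmetric $n\times n$ integer matrix all of whose diagonal entries are even. Then there exist an integer matrix $P$ with $\det(P)=\pm 1$ and non-negative integers $p,r,s,t,m$ such that $P^TAP \pmod{4}$ equals the block diagonal matrix $$N(r,s,t,p,m)=\mathrm{diag}\Big(r\begin{pmatrix}2&1\\1&2\end{pmatrix},\ s\begin{pmatrix}0&1\\1&0\end{pmatrix},\ t\begin{pmatrix}0&2\\2&0\end{pmatrix},\ p\,(2),\ m\,(0)\Big).$$
   Context: For a matrix $M$, "$M \pmod 4$" denotes the matrix of entrywise reductions modulo $4$ (entries in $\{0,1,2,3\}$). The notation $\mathrm{diag}(m_1A_1,\dots,m_kA_k)$ denotes the block diagonal matrix whose diagonal blocks are $m_1$ copies of $A_1$, then $m_2$ copies of $A_2$, ..., then $m_k$ copies of $A_k$. Such a matrix $N(r,s,t,p,m)$ is called a normal form of $A$. -}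

module Defs where

open import Data.Nat as ℕ using (ℕ; zero; suc; _<ᵇ_)
open import Data.Fin using (Fin; zero; suc; toℕ; punchIn)
open import Data.Integer as ℤ using (ℤ; +_; _%ℕ_)
open import Data.Integer.Divisibility using (_∣_)
open import Data.Bool using (if_then_else_)
open import Relation.Binary.PropositionalEquality using (_≡_)

Mat : ℕ → Set
Mat n = Fin n → Fin n → ℤ

∑ : ∀ {n} → (Fin n → ℤ) → ℤ
∑ {zero}  f = + 0
∑ {suc n} f = f zero ℤ.+ ∑ (λ i → f (suc i))

transpose : ∀ {n} → Mat n → Mat n
transpose A i j = A j i

_⊗_ : ∀ {n} → Mat n → Mat n → Mat n
(A ⊗ B) i j = ∑ (λ k → A i k ℤ.* B k j)

sgn : ℕ → ℤ
sgn zero = + 1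
sgn (suc zero) = ℤ.- (+ 1)
sgn (suc (suc k)) = sgn k

det : ∀ {n} → Mat n → ℤ
det {zero}  A = + 1
det {suc n} A = ∑ (λ j → sgn (toℕ j) ℤ.* (A zero j ℤ.* det (λ r c → A (suc r) (punchIn j c))))

Symmetric : ∀ {n} → Mat n → Set
Symmetric A = ∀ i j → A i j ≡ A j i

EvenDiagonal : ∀ {n} → Mat n → Set
EvenDiagonal A = ∀ i → (+ 2) ∣ A i i

-- Blocks in order: r copies of [[2,1],[1,2]], s copies of [[0,1],[1,0]],
-- t copies of [[0,2],[2,0]], p copies of (2), m copies of (0).
-- Entries outside the diagonal blocks are 0.
-- blockEntry d o a b : entry (a,b) inside a run of 2×2 blocks with diagonal
-- value d and off-diagonal value o (a, b are offsets from the start of the run).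
pairEntry : ℕ → ℕ → ℕ → ℕ → ℕ
pairEntry d o a b =
  if ℕ._≡ᵇ_ (a ℕ./ 2) (b ℕ./ 2)
  then (if ℕ._≡ᵇ_ a b then d else o)
  else 0

Nentry : ℕ → ℕ → ℕ → ℕ → ℕ → ℕ → ℕ → ℕ
Nentry r s t p m i j =
  if i <ᵇ 2 ℕ.* r then (if j <ᵇ 2 ℕ.* r then pairEntry 2 1 i j else 0)
  else let i₁ = i ℕ.∸ 2 ℕ.* r ; j₁ = j ℕ.∸ 2 ℕ.* r in
  if j <ᵇ 2 ℕ.* r then 0
  else if i₁ <ᵇ 2 ℕ.* s then (if j₁ <ᵇ 2 ℕ.* s then pairEntry 0 1 i₁ j₁ else 0)
  else let i₂ = i₁ ℕ.∸ 2 ℕ.* s ; j₂ = j₁ ℕ.∸ 2 ℕ.* s in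
  if j₁ <ᵇ 2 ℕ.* s then 0
  else if i₂ <ᵇ 2 ℕ.* t then (if j₂ <ᵇ 2 ℕ.* t then pairEntry 0 2 i₂ j₂ else 0)
  else let i₃ = i₂ ℕ.∸ 2 ℕ.* t ; j₃ = j₂ ℕ.∸ 2 ℕ.* t in
  if j₂ <ᵇ 2 ℕ.* t then 0
  else if ℕ._≡ᵇ_ i₃ j₃ then (if i₃ <ᵇ p then 2 else 0)
  else 0

-- the normal form N(r,s,t,p,m) as an n×n matrix (n = 2r+2s+2t+p+m is
-- imposed separately in the statement)
N : (r s t p m : ℕ) → ∀ {n} → Fin n → Fin n → ℕ
N r s t p m i j = Nentry r s t p m (toℕ i) (toℕ j)

mod4 : ∀ {n} → Mat n → Fin n → Fin n → ℕ
mod4 A i j = A i j %ℕ 4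

{-# OPTIONS --safe #-}
-- Elementary column operations X ↦ X E (transvections and column swaps) have determinant ±1 and act on
-- the Gram matrix by B ↦ Eᵀ B E; we reduce A greedily modulo 4 with this action. If some entry is odd,
-- move it to position (0,1): the 2×2 block it spans is invertible mod 4 and can be brought to
-- E = [[2,1],[1,2]] or H = [[0,1],[1,0]], after which rows 0 and 1 can be cleared mod 4. If all entries
-- are even, a diagonal entry ≡ 2 splits off a block (2) in the same way, an off-diagonal entry ≡ 2 splits
-- off T = [[0,2],[2,0]], and otherwise everything is ≡ 0. Recursing on the complement yields a direct sum
-- of such blocks, which is sorted into the shape of N(r,s,t,p,m) using H ⊕ E ≅ E ⊕ H and
-- (2) ⊕ T ≅ (2) ⊕ (2) ⊕ (2).
module Submission where

open import Data.Nat as ℕ using (ℕ; zero; suc; z≤n; s≤s; _<ᵇ_; _≡ᵇ_; _∸_)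
open import Data.Bool using (true; false; if_then_else_)
import Data.Nat.Properties as ℕP
import Data.Nat.DivMod as ℕD
import Data.Nat.Divisibility as ℕDiv
open import Data.Fin using (Fin; zero; suc; toℕ; punchIn; punchOut; inject₁; _≟_)
import Data.Fin.Properties as FinP
open import Data.Integer as ℤ using (ℤ; +_; _+_; _*_; -_; _-_; _%ℕ_; _/ℕ_; _⊖_)
import Data.Integer.Properties as ℤP
import Data.Integer.DivMod as ℤD
open import Data.Integer.Divisibility.Signed as ℤDiv using (_∣_; divides)
open import Data.Integer.Tactic.RingSolver using (solve-∀)
import Data.Nat.Tactic.RingSolver as ℕSolver
open import Algebra.Properties.Semiring.Sum ℤP.+-*-semiring as Sum using (sum)
open import Data.Vec.Functional using (Vector; updateAt) renaming (_∷_ to _∷ᵥ_)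
open import Data.Vec.Functional.Properties using (updateAt-updates; updateAt-minimal)
open import Data.Fin.Permutation.Components using (transpose-inverse) renaming (transpose to transposition)
open import Data.List using (List; []; _∷_; _++_; foldl; map)
open import Data.List.Properties using (foldl-++)
open import Data.Product using (_×_; _,_; proj₁; proj₂; ∃-syntax)
open import Data.Sum using (_⊎_; inj₁; inj₂)
open import Function using (_∘_)
open import Function.Definitions using (Injective)
open import Relation.Nullary using (¬_; Dec; yes; no; contradiction)
import Relation.Nullary.Decidable as Dec
open import Relation.Binary.PropositionalEquality
open import Relation.Binary using (IsEquivalence; IsPreorder; Setoid; Preorder; Tri; tri<; tri≈; tri>)
import Relation.Binary.Reasoning.Preorder as PreorderReasoning
import Relation.Binary.Reasoning.Setoid as SetoidReasoning
open import Defs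

∑≡sum : ∀ {n} (f : Fin n → ℤ) → ∑ f ≡ sum f
∑≡sum {zero}  f = refl
∑≡sum {suc n} f = cong (_+_ (f zero)) (∑≡sum (f ∘ suc))

∑-cong : ∀ {n} {f g : Fin n → ℤ} → f ≗ g → ∑ f ≡ ∑ g
∑-cong {f = f} {g} f≗g = begin
  ∑ f   ≡⟨ ∑≡sum f ⟩
  sum f ≡⟨ Sum.sum-cong-≗ f≗g ⟩
  sum g ≡⟨ ∑≡sum g ⟨
  ∑ g   ∎
  where open ≡-Reasoning

record Linear {n} (φ : Vector ℤ n → ℤ) : Set where
  field
    cong-≗ : ∀ {f g} → f ≗ g → φ f ≡ φ g
    additive : ∀ f g c → φ (λ k → f k + c * g k) ≡ φ f + c * φ g

∑-linear : ∀ {n} → Linear (∑ {n})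
∑-linear {n} = record { cong-≗ = ∑-cong ; additive = additive }
  where
  open ≡-Reasoning
  additive : ∀ (f g : Fin n → ℤ) c → ∑ (λ k → f k + c * g k) ≡ ∑ f + c * ∑ g
  additive f g c = begin
    ∑ (λ k → f k + c * g k)           ≡⟨ ∑≡sum (λ k → f k + c * g k) ⟩
    sum (λ k → f k + c * g k)         ≡⟨ Sum.∑-distrib-+ f (λ k → c * g k) ⟩
    sum f + sum (λ k → c * g k)       ≡⟨ cong (_+_ (sum f)) (Sum.*-distribˡ-sum c g) ⟨
    sum f + c * sum g                 ≡⟨ cong₂ (λ x y → x + c * y) (∑≡sum f) (∑≡sum g) ⟨
    ∑ f + c * ∑ g                     ∎

∑-remove : ∀ {n} (f : Fin (suc n) → ℤ) a → ∑ f ≡ f a + ∑ (f ∘ punchIn a)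
∑-remove f a = begin
  ∑ f                        ≡⟨ ∑≡sum f ⟩
  sum f                      ≡⟨ Sum.sum-remove {i = a} f ⟩
  f a + sum (f ∘ punchIn a)  ≡⟨ cong (_+_ (f a)) (∑≡sum (f ∘ punchIn a)) ⟨
  f a + ∑ (f ∘ punchIn a)    ∎
  where open ≡-Reasoning

∑-zero : ∀ {n} (f : Fin n → ℤ) → (∀ i → f i ≡ + 0) → ∑ f ≡ + 0
∑-zero {n} f f≗0 = begin
  ∑ f                    ≡⟨ ∑-cong f≗0 ⟩
  ∑ {n} (λ _ → + 0)      ≡⟨ ∑≡sum {n} (λ _ → + 0) ⟩
  sum {n} (λ _ → + 0)    ≡⟨ Sum.sum-replicate-zero n ⟩
  + 0                    ∎
  where open ≡-Reasoning

∑-single : ∀ {n} (f : Fin n → ℤ) a → (∀ j → j ≢ a → f j ≡ + 0) → ∑ f ≡ f a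
∑-single {suc n} f a off = begin
  ∑ f                      ≡⟨ ∑-remove f a ⟩
  f a + ∑ (f ∘ punchIn a)  ≡⟨ cong (_+_ (f a)) (∑-zero _ (λ j → off (punchIn a j) (FinP.punchInᵢ≢i a j))) ⟩
  f a + + 0                ≡⟨ ℤP.+-identityʳ (f a) ⟩
  f a                      ∎
  where open ≡-Reasoning

∑-pair : ∀ {n} (f : Fin n → ℤ) a b → a ≢ b → (∀ j → j ≢ a → j ≢ b → f j ≡ + 0) → ∑ f ≡ f a + f b
∑-pair {suc n} f a b a≢b off = begin
  ∑ f                                  ≡⟨ ∑-remove f a ⟩
  f a + ∑ (f ∘ punchIn a)              ≡⟨ cong (_+_ (f a)) (∑-single _ b′ off′) ⟩
  f a + f (punchIn a b′)               ≡⟨ cong (λ j → f a + f j) (FinP.punchIn-punchOut a≢b) ⟩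
  f a + f b                            ∎
  where
  open ≡-Reasoning
  b′ : Fin n
  b′ = punchOut a≢b
  off′ : ∀ j → j ≢ b′ → f (punchIn a j) ≡ + 0
  off′ j j≢b′ = off (punchIn a j) (FinP.punchInᵢ≢i a j)
    (λ e → j≢b′ (FinP.punchIn-injective a j b′ (trans e (sym (FinP.punchIn-punchOut a≢b)))))

infix 4 _≡₄_
-- A record, so that both sides can be recovered by unification.
record _≡₄_ (a b : ℤ) : Set where
  constructor mk≡₄
  field residues : a %ℕ 4 ≡ b %ℕ 4

≡⇒≡₄ : ∀ {a b} → a ≡ b → a ≡₄ b
≡⇒≡₄ refl = mk≡₄ refl

≡₄-isEquivalence : IsEquivalence _≡₄_
≡₄-isEquivalence = record
  { refl = mk≡₄ refl
  ; sym = λ (mk≡₄ e) → mk≡₄ (sym e)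
  ; trans = λ (mk≡₄ e) (mk≡₄ f) → mk≡₄ (trans e f)
  }

≡₄-setoid : Setoid _ _
≡₄-setoid = record { isEquivalence = ≡₄-isEquivalence }

open IsEquivalence ≡₄-isEquivalence public
  using () renaming (refl to ≡₄-refl; sym to ≡₄-sym; trans to ≡₄-trans)

module ≡₄-Reasoning = SetoidReasoning ≡₄-setoid

≡₄-residue : ∀ x → x ≡₄ + (x %ℕ 4)
≡₄-residue x = mk≡₄ (sym (ℕD.m<n⇒m%n≡m (ℤD.n%ℕd<d x 4)))

≡₄-residue-value : ∀ {x v} → x ≡₄ + v → v ℕ.< 4 → x %ℕ 4 ≡ v
≡₄-residue-value (mk≡₄ x≡v) v<4 = trans x≡v (ℕD.m<n⇒m%n≡m v<4)

residue-unique : ∀ {u v} → u ℕ.< 4 → v ℕ.< 4 → + 4 ∣ + u - + v → u ≡ v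
residue-unique {u} {v} u<4 v<4 4∣u-v =
  ℤP.+-injective (ℤP.i-j≡0⇒i≡j (+ u) (+ v) (trans (ℤP.m-n≡m⊖n u v) (ℤP.∣i∣≡0⇒i≡0 (small-multiple 4∣d d<4))))
  where
  d : ℕ
  d = ℤ.∣ u ⊖ v ∣
  4∣d : 4 ℕDiv.∣ d
  4∣d = subst (λ z → 4 ℕDiv.∣ ℤ.∣ z ∣) (ℤP.m-n≡m⊖n u v) (ℤDiv.∣⇒∣ᵤ 4∣u-v)
  d<4 : d ℕ.< 4
  d<4 = ℕP.≤-<-trans (ℤP.∣m⊝n∣≤m⊔n u v) (ℕP.⊔-lub u<4 v<4)
  small-multiple : ∀ {k} → 4 ℕDiv.∣ k → k ℕ.< 4 → k ≡ 0
  small-multiple {zero} _ _ = refl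
  small-multiple {suc k} 4∣k k<4 = contradiction 4∣k (ℕDiv.>⇒∤ k<4)

≡₄⇒∣ : ∀ {a b} → a ≡₄ b → + 4 ∣ a - b
≡₄⇒∣ {a} {b} (mk≡₄ eq) = divides (a /ℕ 4 - b /ℕ 4) (begin
  a - b                                            ≡⟨ cong₂ _-_ (ℤD.a≡a%ℕn+[a/ℕn]*n a 4) (ℤD.a≡a%ℕn+[a/ℕn]*n b 4) ⟩
  (+ (a %ℕ 4) + a /ℕ 4 * + 4) - (+ (b %ℕ 4) + b /ℕ 4 * + 4)
    ≡⟨ cong (λ r → (+ r + a /ℕ 4 * + 4) - (+ (b %ℕ 4) + b /ℕ 4 * + 4)) eq ⟩
  (+ (b %ℕ 4) + a /ℕ 4 * + 4) - (+ (b %ℕ 4) + b /ℕ 4 * + 4) ≡⟨ cancel (+ (b %ℕ 4)) (a /ℕ 4) (b /ℕ 4) ⟩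
  (a /ℕ 4 - b /ℕ 4) * + 4                           ∎)
  where
  open ≡-Reasoning
  cancel : ∀ r x y → (r + x * + 4) - (r + y * + 4) ≡ (x - y) * + 4
  cancel = solve-∀

∣⇒≡₄ : ∀ {a b} → + 4 ∣ a - b → a ≡₄ b
∣⇒≡₄ {a} {b} 4∣a-b = mk≡₄ (residue-unique (ℤD.n%ℕd<d a 4) (ℤD.n%ℕd<d b 4) (subst (+ 4 ∣_) residue-difference
  (ℤDiv.∣m∣n⇒∣m-n 4∣a-b (ℤDiv.∣n⇒∣m*n (a /ℕ 4 - b /ℕ 4) ℤDiv.∣-refl))))
  where
  shift : ∀ r s x y → ((r + x * + 4) - (s + y * + 4)) - (x - y) * + 4 ≡ r - s
  shift = solve-∀
  residue-difference : (a - b) - (a /ℕ 4 - b /ℕ 4) * + 4 ≡ + (a %ℕ 4) - + (b %ℕ 4)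
  residue-difference = trans
    (cong₂ (λ x y → (x - y) - (a /ℕ 4 - b /ℕ 4) * + 4) (ℤD.a≡a%ℕn+[a/ℕn]*n a 4) (ℤD.a≡a%ℕn+[a/ℕn]*n b 4))
    (shift (+ (a %ℕ 4)) (+ (b %ℕ 4)) (a /ℕ 4) (b /ℕ 4))

+-cong₄ : ∀ {a a′ b b′} → a ≡₄ a′ → b ≡₄ b′ → a + b ≡₄ a′ + b′
+-cong₄ {a} {a′} {b} {b′} p q =
  ∣⇒≡₄ (subst (+ 4 ∣_) (regroup a a′ b b′) (ℤDiv.∣m∣n⇒∣m+n (≡₄⇒∣ p) (≡₄⇒∣ q)))
  where
  regroup : ∀ a a′ b b′ → (a - a′) + (b - b′) ≡ (a + b) - (a′ + b′)
  regroup = solve-∀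

*-cong₄ : ∀ {a a′ b b′} → a ≡₄ a′ → b ≡₄ b′ → a * b ≡₄ a′ * b′
*-cong₄ {a} {a′} {b} {b′} p q =
  ∣⇒≡₄ (subst (+ 4 ∣_) (regroup a a′ b b′)
    (ℤDiv.∣m∣n⇒∣m+n (ℤDiv.∣n⇒∣m*n a (≡₄⇒∣ q)) (ℤDiv.∣m⇒∣m*n b′ (≡₄⇒∣ p))))
  where
  regroup : ∀ a a′ b b′ → a * (b - b′) + (a - a′) * b′ ≡ a * b - a′ * b′
  regroup = solve-∀

Even : ℤ → Set
Even x = + 2 ∣ x

half : ℤ → ℤ
half x = x /ℕ 2

even⇒half*2 : ∀ {x} → Even x → x ≡ half x * + 2
even⇒half*2 {x} (divides q x≡q*2) with x %ℕ 2 | ℤD.n%ℕd<d x 2 | ℤD.a≡a%ℕn+[a/ℕn]*n x 2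
... | 0 | _ | x≡0+h*2 = trans x≡0+h*2 (ℤP.+-identityˡ _)
... | suc (suc _) | s≤s (s≤s ()) | _
... | 1 | _ | x≡1+h*2 =
  contradiction (ℤDiv.∣⇒∣ᵤ (divides (q - half x) (odd-part (trans (sym x≡1+h*2) x≡q*2)))) (ℕDiv.>⇒∤ (s≤s (s≤s z≤n)))
  where
  odd-part : + 1 + half x * + 2 ≡ q * + 2 → + 1 ≡ (q - half x) * + 2
  odd-part e = begin
    + 1                                ≡⟨ cancel (half x) ⟨
    + 1 + half x * + 2 - half x * + 2  ≡⟨ cong (λ y → y - half x * + 2) e ⟩
    q * + 2 - half x * + 2             ≡⟨ factor q (half x) ⟩
    (q - half x) * + 2                 ∎
    where
    open ≡-Reasoning
    cancel : ∀ h → + 1 + h * + 2 - h * + 2 ≡ + 1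
    cancel = solve-∀
    factor : ∀ q h → q * + 2 - h * + 2 ≡ (q - h) * + 2
    factor = solve-∀

infix 4 _≟₄_
_≟₄_ : ∀ a b → Dec (a ≡₄ b)
a ≟₄ b = Dec.map′ mk≡₄ _≡₄_.residues (a %ℕ 4 ℕ.≟ b %ℕ 4)

residue-cases : ∀ x → x ≡₄ + 0 ⊎ x ≡₄ + 1 ⊎ x ≡₄ + 2 ⊎ x ≡₄ + 3
residue-cases x with x %ℕ 4 | ℤD.n%ℕd<d x 4 | ≡₄-residue x
... | 0 | _ | x≡r = inj₁ x≡r
... | 1 | _ | x≡r = inj₂ (inj₁ x≡r)
... | 2 | _ | x≡r = inj₂ (inj₂ (inj₁ x≡r))
... | 3 | _ | x≡r = inj₂ (inj₂ (inj₂ x≡r))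
... | suc (suc (suc (suc _))) | s≤s (s≤s (s≤s (s≤s ()))) | _

≡₄-even : ∀ {x y} → x ≡₄ y → Even x → Even y
≡₄-even {x} {y} x≡y ex = subst Even (x-[x-y]≡y x y)
  (ℤDiv.∣m∣n⇒∣m-n ex (ℤDiv.∣-trans (divides (+ 2) refl) (≡₄⇒∣ x≡y)))
  where
  x-[x-y]≡y : ∀ x y → x - (x - y) ≡ y
  x-[x-y]≡y = solve-∀

¬Even[1] : ¬ Even (+ 1)
¬Even[1] e with even⇒half*2 e
... | ()

¬Even[3] : ¬ Even (+ 3)
¬Even[3] e with even⇒half*2 e
... | ()

even-residue : ∀ {x} → Even x → x ≡₄ + 0 ⊎ x ≡₄ + 2
even-residue {x} ex with residue-cases x
... | inj₁ x≡0               = inj₁ x≡0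
... | inj₂ (inj₁ x≡1)        = contradiction (≡₄-even x≡1 ex) ¬Even[1]
... | inj₂ (inj₂ (inj₁ x≡2)) = inj₂ x≡2
... | inj₂ (inj₂ (inj₂ x≡3)) = contradiction (≡₄-even x≡3 ex) ¬Even[3]

odd-residue : ∀ {x} → ¬ Even x → x ≡₄ + 1 ⊎ x ≡₄ + 3
odd-residue {x} ox with residue-cases x
... | inj₁ x≡0               = contradiction (≡₄-even (≡₄-sym x≡0) (divides (+ 0) refl)) ox
... | inj₂ (inj₁ x≡1)        = inj₁ x≡1
... | inj₂ (inj₂ (inj₁ x≡2)) = contradiction (≡₄-even (≡₄-sym x≡2) (divides (+ 1) refl)) ox
... | inj₂ (inj₂ (inj₂ x≡3)) = inj₂ x≡3

-- Determinants

infix 4 _≗ₘ_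
_≗ₘ_ : ∀ {n} → Mat n → Mat n → Set
A ≗ₘ B = ∀ i j → A i j ≡ B i j

≗ₘ-sym : ∀ {n} {B C : Mat n} → B ≗ₘ C → C ≗ₘ B
≗ₘ-sym B≗C i j = sym (B≗C i j)

minor : ∀ {n} → Fin (suc n) → Mat (suc n) → Mat n
minor j A r c = A (suc r) (punchIn j c)

det-cong : ∀ {n} {A B : Mat n} → A ≗ₘ B → det A ≡ det B
det-cong {zero}  A≗B = refl
det-cong {suc n} A≗B = ∑-cong λ j →
  cong₂ (λ x y → sgn (toℕ j) * (x * y)) (A≗B zero j) (det-cong (λ r c → A≗B (suc r) (punchIn j c)))

laplaceTerm : ∀ {n} → Mat (suc n) → Fin (suc n) → ℤ
laplaceTerm A j = sgn (toℕ j) * (A zero j * det (minor j A))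

record ColumnSum {n} (c : Fin n) (A B C : Mat n) (k : ℤ) : Set where
  field
    left-off  : ∀ i j → j ≢ c → A i j ≡ C i j
    right-off : ∀ i j → j ≢ c → B i j ≡ C i j
    at-column : ∀ i → C i c ≡ A i c + k * B i c

ColumnSum-minor : ∀ {n} {c j : Fin (suc n)} {A B C k} → ColumnSum c A B C k → (j≢c : j ≢ c) →
  ColumnSum (punchOut j≢c) (minor j A) (minor j B) (minor j C) k
ColumnSum-minor {c = c} {j} {A} {B} {C} {k} colSum j≢c = record
  { left-off  = λ r x x≢c′ → left-off (suc r) (punchIn j x) (avoids-c x x≢c′)
  ; right-off = λ r x x≢c′ → right-off (suc r) (punchIn j x) (avoids-c x x≢c′)
  ; at-column = λ r → subst (λ z → C (suc r) z ≡ A (suc r) z + k * B (suc r) z) (sym punchIn-c′) (at-column (suc r))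
  }
  where
  open ColumnSum colSum
  punchIn-c′ : punchIn j (punchOut j≢c) ≡ c
  punchIn-c′ = FinP.punchIn-punchOut j≢c
  avoids-c : ∀ x → x ≢ punchOut j≢c → punchIn j x ≢ c
  avoids-c x x≢c′ e = x≢c′ (FinP.punchIn-injective j x (punchOut j≢c) (trans e (sym punchIn-c′)))

ColumnSum-laplaceTerm-at : ∀ {n} {c : Fin (suc n)} {A B C k} → ColumnSum c A B C k →
  laplaceTerm C c ≡ laplaceTerm A c + k * laplaceTerm B c
ColumnSum-laplaceTerm-at {c = c} {A} {B} {C} {k} colSum = begin
  sgn (toℕ c) * (C zero c * det (minor c C))
    ≡⟨ cong₂ (λ x y → sgn (toℕ c) * (x * y)) (at-column zero) (det-cong (≗ₘ-sym minorA≗minorC)) ⟩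
  sgn (toℕ c) * ((A zero c + k * B zero c) * det (minor c A))
    ≡⟨ expand (sgn (toℕ c)) (A zero c) (B zero c) (det (minor c A)) k ⟩
  laplaceTerm A c + k * (sgn (toℕ c) * (B zero c * det (minor c A)))
    ≡⟨ cong (λ y → laplaceTerm A c + k * (sgn (toℕ c) * (B zero c * y))) (det-cong minorA≗minorB) ⟩
  laplaceTerm A c + k * laplaceTerm B c ∎
  where
  open ≡-Reasoning
  open ColumnSum colSum
  expand : ∀ s a b d k → s * ((a + k * b) * d) ≡ s * (a * d) + k * (s * (b * d))
  expand = solve-∀
  minorA≗minorC : minor c A ≗ₘ minor c C
  minorA≗minorC r x = left-off (suc r) (punchIn c x) (FinP.punchInᵢ≢i c x)
  minorA≗minorB : minor c A ≗ₘ minor c B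
  minorA≗minorB r x = trans (minorA≗minorC r x) (sym (right-off (suc r) (punchIn c x) (FinP.punchInᵢ≢i c x)))

det-linear-in-column : ∀ {n} {c : Fin n} {A B C k} → ColumnSum c A B C k → det C ≡ det A + k * det B
det-linear-in-column {suc n} {c} {A} {B} {C} {k} colSum =
  trans (∑-cong term) (Linear.additive ∑-linear (laplaceTerm A) (laplaceTerm B) k)
  where
  open ColumnSum colSum
  expand : ∀ s a x y k → s * (a * (x + k * y)) ≡ s * (a * x) + k * (s * (a * y))
  expand = solve-∀
  term : ∀ j → laplaceTerm C j ≡ laplaceTerm A j + k * laplaceTerm B j
  term j with j ≟ c
  ... | yes refl = ColumnSum-laplaceTerm-at colSum
  ... | no j≢c = begin
    sgn (toℕ j) * (C zero j * det (minor j C))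
      ≡⟨ cong₂ (λ x y → sgn (toℕ j) * (x * y)) (sym (left-off zero j j≢c)) (det-linear-in-column (ColumnSum-minor colSum j≢c)) ⟩
    sgn (toℕ j) * (A zero j * (det (minor j A) + k * det (minor j B)))
      ≡⟨ expand (sgn (toℕ j)) (A zero j) (det (minor j A)) (det (minor j B)) k ⟩
    laplaceTerm A j + k * (sgn (toℕ j) * (A zero j * det (minor j B)))
      ≡⟨ cong (λ y → laplaceTerm A j + k * (sgn (toℕ j) * (y * det (minor j B))))
              (trans (left-off zero j j≢c) (sym (right-off zero j j≢c))) ⟩
    laplaceTerm A j + k * laplaceTerm B j ∎
    where open ≡-Reasoning

data Adjacent : ∀ {n} → Fin n → Fin n → Set where
  here  : ∀ {n} → Adjacent {suc (suc n)} zero (suc zero)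
  there : ∀ {n} {a b : Fin (suc n)} → Adjacent a b → Adjacent {suc (suc n)} (suc a) (suc b)

adjacent-suc : ∀ {n} {a b : Fin n} → Adjacent a b → Adjacent (suc a) (suc b)
adjacent-suc here      = there here
adjacent-suc (there x) = there (there x)

inject₁-adjacent : ∀ {n} (i : Fin n) → Adjacent (inject₁ i) (suc i)
inject₁-adjacent zero    = here
inject₁-adjacent (suc i) = there (inject₁-adjacent i)

adjacent-toℕ : ∀ {n} {a b : Fin n} → Adjacent a b → toℕ b ≡ suc (toℕ a)
adjacent-toℕ here      = refl
adjacent-toℕ (there x) = cong suc (adjacent-toℕ x)

adjacent⇒≢ : ∀ {n} {a b : Fin n} → Adjacent a b → a ≢ b
adjacent⇒≢ (there x) e = adjacent⇒≢ x (FinP.suc-injective e)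

punchIn-adjacent : ∀ {n} {a b : Fin (suc n)} → Adjacent a b → ∀ x →
  punchIn a x ≡ punchIn b x ⊎ (punchIn a x ≡ b × punchIn b x ≡ a)
punchIn-adjacent here      zero    = inj₂ (refl , refl)
punchIn-adjacent here      (suc x) = inj₁ refl
punchIn-adjacent (there _) zero    = inj₁ refl
punchIn-adjacent {suc n} (there adj) (suc x) with punchIn-adjacent adj x
... | inj₁ e         = inj₁ (cong suc e)
... | inj₂ (e₁ , e₂) = inj₂ (cong suc e₁ , cong suc e₂)

adjacent-punchOut : ∀ {n} {a b j : Fin (suc n)} → Adjacent a b → j ≢ a → j ≢ b →
  ∃[ a′ ] ∃[ b′ ] Adjacent a′ b′ × punchIn j a′ ≡ a × punchIn j b′ ≡ b
adjacent-punchOut {j = zero}     here j≢a j≢b = contradiction refl j≢a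
adjacent-punchOut {j = suc zero} here j≢a j≢b = contradiction refl j≢b
adjacent-punchOut {suc (suc n)} {j = suc (suc j)} here j≢a j≢b = zero , suc zero , here , refl , refl
adjacent-punchOut {j = zero} (there {a = a} {b} adj) j≢a j≢b = a , b , adj , refl , refl
adjacent-punchOut {suc n} {j = suc j} (there adj) j≢a j≢b
  with adjacent-punchOut {j = j} adj (j≢a ∘ cong suc) (j≢b ∘ cong suc)
... | a′ , b′ , adj′ , e₁ , e₂ = suc a′ , suc b′ , adjacent-suc adj′ , cong suc e₁ , cong suc e₂

sgn-suc : ∀ k → sgn (suc k) ≡ - sgn k
sgn-suc zero    = refl
sgn-suc (suc k) = trans (sym (ℤP.neg-involutive (sgn k))) (cong -_ (sym (sgn-suc k)))

det-adjacent-equal-columns : ∀ {n} (A : Mat n) {a b} → Adjacent a b → (∀ i → A i a ≡ A i b) → det A ≡ + 0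
det-adjacent-equal-columns {suc n} A {a} {b} adj cols = begin
  det A                                                ≡⟨ ∑-pair (laplaceTerm A) a b (adjacent⇒≢ adj) others-vanish ⟩
  laplaceTerm A a + sgn (toℕ b) * (A zero b * det (minor b A))
    ≡⟨ cong₂ (λ s x → laplaceTerm A a + s * (x * det (minor b A))) sgn-b (sym (cols zero)) ⟩
  laplaceTerm A a + - sgn (toℕ a) * (A zero a * det (minor b A))
    ≡⟨ cong (λ d → laplaceTerm A a + - sgn (toℕ a) * (A zero a * d)) (det-cong minors-agree) ⟨
  laplaceTerm A a + - sgn (toℕ a) * (A zero a * det (minor a A)) ≡⟨ cancel (sgn (toℕ a)) (A zero a) (det (minor a A)) ⟩
  + 0                                                  ∎
  where
  open ≡-Reasoning
  cancel : ∀ s x d → s * (x * d) + - s * (x * d) ≡ + 0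
  cancel = solve-∀
  sgn-b : sgn (toℕ b) ≡ - sgn (toℕ a)
  sgn-b = trans (cong sgn (adjacent-toℕ adj)) (sgn-suc (toℕ a))
  minors-agree : minor a A ≗ₘ minor b A
  minors-agree r x with punchIn-adjacent adj x
  ... | inj₁ e         = cong (A (suc r)) e
  ... | inj₂ (e₁ , e₂) = trans (cong (A (suc r)) e₁) (trans (sym (cols (suc r))) (cong (A (suc r)) (sym e₂)))
  others-vanish : ∀ j → j ≢ a → j ≢ b → laplaceTerm A j ≡ + 0
  others-vanish j j≢a j≢b with adjacent-punchOut adj j≢a j≢b
  ... | a′ , b′ , adj′ , e₁ , e₂ = begin
    sgn (toℕ j) * (A zero j * det (minor j A)) ≡⟨ cong (λ d → sgn (toℕ j) * (A zero j * d)) minor-vanishes ⟩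
    sgn (toℕ j) * (A zero j * + 0)             ≡⟨ annihilate (sgn (toℕ j)) (A zero j) ⟩
    + 0                                        ∎
    where
    annihilate : ∀ s x → s * (x * + 0) ≡ + 0
    annihilate = solve-∀
    minor-vanishes : det (minor j A) ≡ + 0
    minor-vanishes = det-adjacent-equal-columns (minor j A) adj′
      (λ r → trans (cong (A (suc r)) e₁) (trans (cols (suc r)) (cong (A (suc r)) (sym e₂))))

transposition-matchˡ : ∀ {n} (a b : Fin n) → transposition a b a ≡ b
transposition-matchˡ a b with a ≟ a
... | yes _  = refl
... | no a≢a = contradiction refl a≢a

transposition-matchʳ : ∀ {n} (a b : Fin n) → transposition a b b ≡ a
transposition-matchʳ a b with b ≟ a
... | yes b≡a = b≡a
... | no _ with b ≟ b
...   | yes _  = refl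
...   | no b≢b = contradiction refl b≢b

transposition-other : ∀ {n} {a b j : Fin n} → j ≢ a → j ≢ b → transposition a b j ≡ j
transposition-other {a = a} {b} {j} j≢a j≢b with j ≟ a
... | yes j≡a = contradiction j≡a j≢a
... | no _ with j ≟ b
...   | yes j≡b = contradiction j≡b j≢b
...   | no _    = refl

swapColumns : ∀ {n} → Fin n → Fin n → Mat n → Mat n
swapColumns a b A i j = A i (transposition a b j)

replaceColumn : ∀ {n} → Fin n → Vector ℤ n → Mat n → Mat n
replaceColumn c v A i = updateAt (A i) c (λ _ → v i)

replaceColumn-at : ∀ {n} c (v : Vector ℤ n) A i → replaceColumn c v A i c ≡ v i
replaceColumn-at c v A i = updateAt-updates c (A i)

replaceColumn-off : ∀ {n} {c j} (v : Vector ℤ n) A i → j ≢ c → replaceColumn c v A i j ≡ A i j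
replaceColumn-off {c = c} {j} v A i j≢c = updateAt-minimal j c (A i) j≢c

replaceColumns : ∀ {n} → Fin n → Fin n → Vector ℤ n → Vector ℤ n → Mat n → Mat n
replaceColumns a b x y A = replaceColumn a x (replaceColumn b y A)

module _ {n} {a b : Fin n} (a≢b : a ≢ b) (A : Mat n) where

  replaceColumns-at-a : ∀ x y i → replaceColumns a b x y A i a ≡ x i
  replaceColumns-at-a x y i = replaceColumn-at a x (replaceColumn b y A) i

  replaceColumns-at-b : ∀ x y i → replaceColumns a b x y A i b ≡ y i
  replaceColumns-at-b x y i = trans (replaceColumn-off x (replaceColumn b y A) i (a≢b ∘ sym)) (replaceColumn-at b y A i)

  replaceColumns-elsewhere : ∀ x y i {j} → j ≢ a → j ≢ b → replaceColumns a b x y A i j ≡ A i j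
  replaceColumns-elsewhere x y i j≢a j≢b = trans (replaceColumn-off x (replaceColumn b y A) i j≢a) (replaceColumn-off y A i j≢b)

  replaceColumns-sumˡ : ∀ x x′ y k →
    ColumnSum a (replaceColumns a b x y A) (replaceColumns a b x′ y A) (replaceColumns a b (λ i → x i + k * x′ i) y A) k
  replaceColumns-sumˡ x x′ y k = record
    { left-off  = λ i j j≢a → trans (replaceColumn-off x B i j≢a) (sym (replaceColumn-off z B i j≢a))
    ; right-off = λ i j j≢a → trans (replaceColumn-off x′ B i j≢a) (sym (replaceColumn-off z B i j≢a))
    ; at-column = λ i → trans (replaceColumns-at-a z y i)
                        (sym (cong₂ (λ p q → p + k * q) (replaceColumns-at-a x y i) (replaceColumns-at-a x′ y i)))
    }
    where
    B : Mat n
    B = replaceColumn b y A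
    z : Vector ℤ n
    z i = x i + k * x′ i

  replaceColumns-sumʳ : ∀ x y y′ k →
    ColumnSum b (replaceColumns a b x y A) (replaceColumns a b x y′ A) (replaceColumns a b x (λ i → y i + k * y′ i) A) k
  replaceColumns-sumʳ x y y′ k = record
    { left-off  = λ i j j≢b → off-b y i j≢b
    ; right-off = λ i j j≢b → off-b y′ i j≢b
    ; at-column = λ i → trans (replaceColumns-at-b x z i)
                        (sym (cong₂ (λ p q → p + k * q) (replaceColumns-at-b x y i) (replaceColumns-at-b x y′ i)))
    }
    where
    z : Vector ℤ n
    z i = y i + k * y′ i
    off-b : ∀ z′ i {j} → j ≢ b → replaceColumns a b x z′ A i j ≡ replaceColumns a b x z A i j
    off-b z′ i {j} j≢b with j ≟ a
    ... | yes refl = trans (replaceColumns-at-a x z′ i) (sym (replaceColumns-at-a x z i))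
    ... | no j≢a   = trans (replaceColumns-elsewhere x z′ i j≢a j≢b) (sym (replaceColumns-elsewhere x z i j≢a j≢b))

det-swapColumns-if-alternating : ∀ {n} {a b : Fin n} → a ≢ b →
  (∀ (M : Mat n) → (∀ i → M i a ≡ M i b) → det M ≡ + 0) →
  ∀ A → det (swapColumns a b A) ≡ - det A
det-swapColumns-if-alternating {n} {a} {b} a≢b alternating A = inverseʳ-unique (det A) (det (swapColumns a b A)) (begin
  det A + det (swapColumns a b A)                       ≡⟨ cong₂ _+_ (det-cong R-uv) (det-cong R-vu) ⟨
  det (R u v) + det (R v u)                             ≡⟨ simplify (det (R u v)) (det (R v u)) ⟨
  (+ 0 + + 1 * det (R u v)) + + 1 * (det (R v u) + + 1 * + 0)
    ≡⟨ cong₂ (λ p q → (p + + 1 * det (R u v)) + + 1 * (det (R v u) + + 1 * q)) (vanishes u) (vanishes v) ⟨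
  (det (R u u) + + 1 * det (R u v)) + + 1 * (det (R v u) + + 1 * det (R v v))
    ≡⟨ cong₂ (λ p q → p + + 1 * q) (det-linear-in-column (replaceColumns-sumʳ a≢b A u u v (+ 1)))
                                   (det-linear-in-column (replaceColumns-sumʳ a≢b A v u v (+ 1))) ⟨
  det (R u w) + + 1 * det (R v w)                       ≡⟨ det-linear-in-column (replaceColumns-sumˡ a≢b A u v w (+ 1)) ⟨
  det (R w w)                                           ≡⟨ vanishes w ⟩
  + 0                                                   ∎)
  where
  open ≡-Reasoning
  open import Algebra.Properties.AbelianGroup ℤP.+-0-abelianGroup using (inverseʳ-unique)
  R : Vector ℤ n → Vector ℤ n → Mat n
  R x y = replaceColumns a b x y A
  u v w : Vector ℤ n
  u i = A i a
  v i = A i b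
  w i = u i + + 1 * v i
  simplify : ∀ x y → (+ 0 + + 1 * x) + + 1 * (y + + 1 * + 0) ≡ x + y
  simplify = solve-∀
  vanishes : ∀ x → det (R x x) ≡ + 0
  vanishes x = alternating (R x x) (λ i → trans (replaceColumns-at-a a≢b A x x i) (sym (replaceColumns-at-b a≢b A x x i)))
  R-uv : R u v ≗ₘ A
  R-uv i j with j ≟ a | j ≟ b
  ... | yes refl | _        = replaceColumns-at-a a≢b A u v i
  ... | no _     | yes refl = replaceColumns-at-b a≢b A u v i
  ... | no j≢a   | no j≢b   = replaceColumns-elsewhere a≢b A u v i j≢a j≢b
  R-vu : R v u ≗ₘ swapColumns a b A
  R-vu i j = by-position (j ≟ a) (j ≟ b)
    where
    by-position : Dec (j ≡ a) → Dec (j ≡ b) → R v u i j ≡ swapColumns a b A i j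
    by-position (yes refl) _          = trans (replaceColumns-at-a a≢b A v u i) (cong (A i) (sym (transposition-matchˡ a b)))
    by-position (no _)     (yes refl) = trans (replaceColumns-at-b a≢b A v u i) (cong (A i) (sym (transposition-matchʳ a b)))
    by-position (no j≢a)   (no j≢b)   =
      trans (replaceColumns-elsewhere a≢b A v u i j≢a j≢b) (cong (A i) (sym (transposition-other j≢a j≢b)))

-- Induction on the distance between the columns: swap the right one with its left neighbour.
det-equal-columns-at-distance : ∀ d {n} (A : Mat n) {a b} → toℕ b ≡ suc (d ℕ.+ toℕ a) →
  (∀ i → A i a ≡ A i b) → det A ≡ + 0
det-equal-columns-at-distance zero A {a} {suc i} dist cols =
  det-adjacent-equal-columns A (subst (λ c → Adjacent c (suc i)) inject₁i≡a (inject₁-adjacent i)) cols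
  where
  inject₁i≡a : inject₁ i ≡ a
  inject₁i≡a = FinP.toℕ-injective (trans (FinP.toℕ-inject₁ i) (ℕP.suc-injective dist))
det-equal-columns-at-distance (suc d) A {a} {suc i} dist cols = begin
  det A                       ≡⟨ ℤP.neg-involutive (det A) ⟨
  - (- det A)                 ≡⟨ cong -_ (det-swapColumns-if-alternating c≢b (λ M → det-adjacent-equal-columns M adj) A) ⟨
  - det (swapColumns c b A)   ≡⟨ cong -_ (det-equal-columns-at-distance d (swapColumns c b A) dist′ swapped-cols) ⟩
  + 0                         ∎
  where
  open ≡-Reasoning
  b c : Fin (suc _)
  b = suc i
  c = inject₁ i
  adj : Adjacent c b
  adj = inject₁-adjacent i
  c≢b : c ≢ b
  c≢b = adjacent⇒≢ adj
  dist′ : toℕ c ≡ suc (d ℕ.+ toℕ a)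
  dist′ = trans (FinP.toℕ-inject₁ i) (ℕP.suc-injective dist)
  a≢c : a ≢ c
  a≢c a≡c = ℕP.<⇒≢ (s≤s (ℕP.m≤n+m (toℕ a) d)) (trans (cong toℕ a≡c) dist′)
  a≢b : a ≢ b
  a≢b a≡b = ℕP.<⇒≢ (s≤s (ℕP.m≤n+m (toℕ a) (suc d))) (trans (cong toℕ a≡b) dist)
  swapped-cols : ∀ k → swapColumns c b A k a ≡ swapColumns c b A k c
  swapped-cols k = trans (cong (A k) (transposition-other a≢c a≢b))
    (trans (cols k) (cong (A k) (sym (transposition-matchˡ c b))))

det-equal-columns : ∀ {n} (A : Mat n) {a b} → a ≢ b → (∀ i → A i a ≡ A i b) → det A ≡ + 0
det-equal-columns A {a} {b} a≢b cols = by-order (ℕP.<-cmp (toℕ a) (toℕ b))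
  where
  distance : ∀ {x y} → x ℕ.< y → y ≡ suc ((y ℕ.∸ suc x) ℕ.+ x)
  distance {x} {y} x<y = trans (sym (ℕP.m+[n∸m]≡n x<y)) (cong suc (ℕP.+-comm x (y ℕ.∸ suc x)))
  by-order : Tri (toℕ a ℕ.< toℕ b) (toℕ a ≡ toℕ b) (toℕ b ℕ.< toℕ a) → det A ≡ + 0
  by-order (tri< a<b _ _) = det-equal-columns-at-distance _ A (distance a<b) cols
  by-order (tri≈ _ a≡b _) = contradiction (FinP.toℕ-injective a≡b) a≢b
  by-order (tri> _ _ b<a) = det-equal-columns-at-distance _ A (distance b<a) (sym ∘ cols)

det-swapColumns : ∀ {n} {a b : Fin n} → a ≢ b → ∀ A → det (swapColumns a b A) ≡ - det A
det-swapColumns a≢b = det-swapColumns-if-alternating a≢b (λ M → det-equal-columns M a≢b)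

det-addColumn : ∀ {n} {a p : Fin n} → a ≢ p → ∀ c (X : Mat n) →
  det (λ i → updateAt (X i) a (_+ c * X i p)) ≡ det X
det-addColumn {n} {a} {p} a≢p c X = begin
  det (λ i → updateAt (X i) a (_+ c * X i p))  ≡⟨ det-linear-in-column column-a ⟩
  det X + c * det Y                            ≡⟨ cong (λ d → det X + c * d) (det-equal-columns Y a≢p Y-cols) ⟩
  det X + c * + 0                              ≡⟨ cong (_+_ (det X)) (ℤP.*-zeroʳ c) ⟩
  det X + + 0                                  ≡⟨ ℤP.+-identityʳ (det X) ⟩
  det X                                        ∎
  where
  open ≡-Reasoning
  Y : Mat n
  Y = replaceColumn a (λ k → X k p) X
  Y-cols : ∀ i → Y i a ≡ Y i p
  Y-cols i = trans (replaceColumn-at a (λ k → X k p) X i) (sym (replaceColumn-off (λ k → X k p) X i (a≢p ∘ sym)))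
  column-a : ColumnSum a X Y (λ i → updateAt (X i) a (_+ c * X i p)) c
  column-a = record
    { left-off  = λ i j j≢a → sym (updateAt-minimal j a (X i) j≢a)
    ; right-off = λ i j j≢a → trans (replaceColumn-off (λ k → X k p) X i j≢a) (sym (updateAt-minimal j a (X i) j≢a))
    ; at-column = λ i → trans (updateAt-updates a (X i)) (cong (λ y → X i a + c * y) (sym (replaceColumn-at a (λ k → X k p) X i)))
    }

1ₘ : ∀ {n} → Mat n
1ₘ zero    zero    = + 1
1ₘ zero    (suc _) = + 0
1ₘ (suc _) zero    = + 0
1ₘ (suc i) (suc j) = 1ₘ i j

det-1ₘ : ∀ {n} → det (1ₘ {n}) ≡ + 1
det-1ₘ {zero}  = refl
det-1ₘ {suc n} = cong₂ _+_ (cong (λ d → + 1 * (+ 1 * d)) (det-1ₘ {n})) (∑-zero off-diagonal vanishes)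
  where
  off-diagonal : Fin n → ℤ
  off-diagonal j = sgn (toℕ (suc j)) * (+ 0 * det (minor (suc j) 1ₘ))
  vanishes : ∀ j → off-diagonal j ≡ + 0
  vanishes j = ℤP.*-zeroʳ (sgn (toℕ (suc j)))

-- Elementary operations and the congruence action

data ElemOp (n : ℕ) : Set where
  addMul : (a p : Fin n) → a ≢ p → ℤ → ElemOp n
  swap   : Fin n → Fin n → ElemOp n

colOp : ∀ {n} → ElemOp n → Vector ℤ n → Vector ℤ n
colOp (addMul a p _ c) v = updateAt v a (_+ c * v p)
colOp (swap a b)       v = v ∘ transposition a b

infixl 5 _◁_ _◁*_
_◁_ : ∀ {n} → Mat n → ElemOp n → Mat n
(X ◁ o) k = colOp o (X k)

_◁*_ : ∀ {n} → Mat n → List (ElemOp n) → Mat n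
X ◁* L = foldl _◁_ X L

-- With E the elementary matrix of o, X ◁ o = X E and act o B = Eᵀ B E.
act : ∀ {n} → ElemOp n → Mat n → Mat n
act o B i j = colOp o (λ k → colOp o (B k) j) i

act* : ∀ {n} → List (ElemOp n) → Mat n → Mat n
act* L B = foldl (λ C o → act o C) B L

act*-++ : ∀ {n} L L′ (B : Mat n) → act* (L ++ L′) B ≡ act* L′ (act* L B)
act*-++ L L′ B = foldl-++ (λ C o → act o C) B L L′

Unimodular : ∀ {n} → Mat n → Set
Unimodular X = det X ≡ + 1 ⊎ det X ≡ - (+ 1)

transposition-refl : ∀ {n} (a j : Fin n) → transposition a a j ≡ j
transposition-refl a j with j ≟ a
... | yes j≡a = sym j≡a
... | no _ with j ≟ a
...   | yes j≡a = sym j≡a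
...   | no _    = refl

det-◁ : ∀ {n} (X : Mat n) o → det (X ◁ o) ≡ det X ⊎ det (X ◁ o) ≡ - det X
det-◁ X (addMul a p a≢p c) = inj₁ (det-addColumn a≢p c X)
det-◁ X (swap a b) with a ≟ b
... | yes refl = inj₁ (det-cong (λ i j → cong (X i) (transposition-refl a j)))
... | no a≢b   = inj₂ (det-swapColumns a≢b X)

unimodular-◁* : ∀ {n} {X : Mat n} → Unimodular X → ∀ L → Unimodular (X ◁* L)
unimodular-◁* u [] = u
unimodular-◁* {X = X} u (o ∷ L) = unimodular-◁* (step (det-◁ X o) u) L
  where
  step : det (X ◁ o) ≡ det X ⊎ det (X ◁ o) ≡ - det X → Unimodular X → Unimodular (X ◁ o)
  step (inj₁ e) (inj₁ d) = inj₁ (trans e d)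
  step (inj₁ e) (inj₂ d) = inj₂ (trans e d)
  step (inj₂ e) (inj₁ d) = inj₂ (trans e (cong -_ d))
  step (inj₂ e) (inj₂ d) = inj₁ (trans e (cong -_ d))

colOp-pointwise : ∀ {n} (_∼_ : ℤ → ℤ → Set) →
  (∀ {x x′ y y′} c → x ∼ x′ → y ∼ y′ → (x + c * y) ∼ (x′ + c * y′)) →
  ∀ o {u v : Vector ℤ n} → (∀ k → u k ∼ v k) → ∀ j → colOp o u j ∼ colOp o v j
colOp-pointwise _∼_ combine (addMul a p _ c) {u} {v} u∼v j with j ≟ a
... | yes refl = subst₂ _∼_ (sym (updateAt-updates j u)) (sym (updateAt-updates j v)) (combine c (u∼v j) (u∼v p))
... | no j≢a   = subst₂ _∼_ (sym (updateAt-minimal j a u j≢a)) (sym (updateAt-minimal j a v j≢a)) (u∼v j)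
colOp-pointwise _∼_ combine (swap a b) u∼v j = u∼v (transposition a b j)

act-pointwise : ∀ {n} (_∼_ : ℤ → ℤ → Set) →
  (∀ {x x′ y y′} c → x ∼ x′ → y ∼ y′ → (x + c * y) ∼ (x′ + c * y′)) →
  ∀ o {B C : Mat n} → (∀ i j → B i j ∼ C i j) → ∀ i j → act o B i j ∼ act o C i j
act-pointwise _∼_ combine o B∼C i j =
  colOp-pointwise _∼_ combine o (λ k → colOp-pointwise _∼_ combine o (B∼C k) j) i

colOp-cong : ∀ {n} o {u v : Vector ℤ n} → u ≗ v → colOp o u ≗ colOp o v
colOp-cong = colOp-pointwise _≡_ (λ c → cong₂ (λ x y → x + c * y))

act-cong : ∀ {n} o {B C : Mat n} → B ≗ₘ C → act o B ≗ₘ act o C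
act-cong = act-pointwise _≡_ (λ c → cong₂ (λ x y → x + c * y))

act*-cong : ∀ {n} L {B C : Mat n} → B ≗ₘ C → act* L B ≗ₘ act* L C
act*-cong []      B≗C = B≗C
act*-cong (o ∷ L) B≗C = act*-cong L (act-cong o B≗C)

linear-eval : ∀ {n} (k : Fin n) → Linear (λ u → u k)
linear-eval k = record { cong-≗ = λ f≗g → f≗g k ; additive = λ _ _ _ → refl }

linear-*ʳ : ∀ {n} {φ : Vector ℤ n → ℤ} → Linear φ → ∀ d → Linear (λ u → φ u * d)
linear-*ʳ {φ = φ} lin d = record
  { cong-≗ = λ f≗g → cong (_* d) (Linear.cong-≗ lin f≗g)
  ; additive = λ f g c → trans (cong (_* d) (Linear.additive lin f g c)) (distrib (φ f) (φ g) c d)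
  }
  where
  distrib : ∀ x y c d → (x + c * y) * d ≡ x * d + c * (y * d)
  distrib = solve-∀

linear-*ˡ : ∀ {n} {φ : Vector ℤ n → ℤ} d → Linear φ → Linear (λ u → d * φ u)
linear-*ˡ {φ = φ} d lin = record
  { cong-≗ = λ f≗g → cong (d *_) (Linear.cong-≗ lin f≗g)
  ; additive = λ f g c → trans (cong (d *_) (Linear.additive lin f g c)) (distrib (φ f) (φ g) c d)
  }
  where
  distrib : ∀ x y c d → d * (x + c * y) ≡ d * x + c * (d * y)
  distrib = solve-∀

linear-∑ : ∀ {m n} {φ : Fin m → Vector ℤ n → ℤ} → (∀ k → Linear (φ k)) → Linear (λ u → ∑ (λ k → φ k u))
linear-∑ {φ = φ} lin = record
  { cong-≗ = λ f≗g → ∑-cong (λ k → Linear.cong-≗ (lin k) f≗g)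
  ; additive = λ f g c → trans (∑-cong (λ k → Linear.additive (lin k) f g c))
                               (Linear.additive ∑-linear (λ k → φ k f) (λ k → φ k g) c)
  }

colOp-linear : ∀ {n} o (i : Fin n) → Linear (λ v → colOp o v i)
colOp-linear (addMul a p a≢p c) i = record { cong-≗ = λ f≗g → colOp-cong (addMul a p a≢p c) f≗g i ; additive = additive }
  where
  regroup : ∀ x y u v c d → (x + c * y) + d * (u + c * v) ≡ (x + d * u) + c * (y + d * v)
  regroup = solve-∀
  additive : ∀ f g d → updateAt (λ k → f k + d * g k) a (_+ c * (f p + d * g p)) i
                     ≡ updateAt f a (_+ c * f p) i + d * updateAt g a (_+ c * g p) i
  additive f g d with i ≟ a
  ... | yes refl = begin
    updateAt (λ k → f k + d * g k) i (_+ c * (f p + d * g p)) i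
      ≡⟨ updateAt-updates i (λ k → f k + d * g k) ⟩
    (f i + d * g i) + c * (f p + d * g p)
      ≡⟨ regroup (f i) (g i) (f p) (g p) d c ⟩
    (f i + c * f p) + d * (g i + c * g p)
      ≡⟨ cong₂ (λ x y → x + d * y) (updateAt-updates i f) (updateAt-updates i g) ⟨
    updateAt f i (_+ c * f p) i + d * updateAt g i (_+ c * g p) i ∎
    where open ≡-Reasoning
  ... | no i≢a = trans (updateAt-minimal i a (λ k → f k + d * g k) i≢a)
    (cong₂ (λ x y → x + d * y) (sym (updateAt-minimal i a f i≢a)) (sym (updateAt-minimal i a g i≢a)))
colOp-linear (swap a b) i = linear-eval (transposition a b i)

colOp-commutes-linear : ∀ {m n} {φ : Vector ℤ m → ℤ} → Linear φ → ∀ o (Y : Fin m → Vector ℤ n) j →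
  φ (λ k → colOp o (Y k) j) ≡ colOp o (λ l → φ (λ k → Y k l)) j
colOp-commutes-linear {φ = φ} lin (addMul a p a≢p c) Y j with j ≟ a
... | yes refl = begin
  φ (λ k → updateAt (Y k) j (_+ c * Y k p) j)      ≡⟨ Linear.cong-≗ lin (λ k → updateAt-updates j (Y k)) ⟩
  φ (λ k → Y k j + c * Y k p)                      ≡⟨ Linear.additive lin (λ k → Y k j) (λ k → Y k p) c ⟩
  φ (λ k → Y k j) + c * φ (λ k → Y k p)            ≡⟨ updateAt-updates j (λ l → φ (λ k → Y k l)) ⟨
  colOp (addMul j p a≢p c) (λ l → φ (λ k → Y k l)) j ∎
  where open ≡-Reasoning
... | no j≢a = trans (Linear.cong-≗ lin (λ k → updateAt-minimal j a (Y k) j≢a))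
                     (sym (updateAt-minimal j a (λ l → φ (λ k → Y k l)) j≢a))
colOp-commutes-linear lin (swap a b) Y j = refl

act-symmetric : ∀ {n} o {B : Mat n} → Symmetric B → Symmetric (act o B)
act-symmetric o {B} sym-B i j = begin
  colOp o (λ k → colOp o (B k) j) i   ≡⟨ colOp-commutes-linear (colOp-linear o i) o B j ⟩
  colOp o (λ l → colOp o (λ k → B k l) i) j
    ≡⟨ colOp-cong o (λ l → colOp-cong o (λ k → sym-B k l) i) j ⟩
  colOp o (λ l → colOp o (B l) i) j   ∎
  where open ≡-Reasoning

act*-symmetric : ∀ {n} L {B : Mat n} → Symmetric B → Symmetric (act* L B)
act*-symmetric []      sym-B = sym-B
act*-symmetric (o ∷ L) sym-B = act*-symmetric L (act-symmetric o sym-B)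

Gram : ∀ {n} → Mat n → Mat n → Mat n
Gram A X = (transpose X ⊗ A) ⊗ X

form : ∀ {n} → Mat n → Vector ℤ n → Vector ℤ n → ℤ
form A u v = ∑ (λ k → ∑ (λ l → u l * A l k) * v k)

form-linearˡ : ∀ {n} (A : Mat n) v → Linear (λ u → form A u v)
form-linearˡ A v = linear-∑ (λ k → linear-*ʳ (linear-∑ (λ l → linear-*ʳ (linear-eval l) (A l k))) (v k))

form-linearʳ : ∀ {n} (A : Mat n) u → Linear (form A u)
form-linearʳ A u = linear-∑ (λ k → linear-*ˡ (∑ (λ l → u l * A l k)) (linear-eval k))

Gram-◁ : ∀ {n} (A X : Mat n) o → Gram A (X ◁ o) ≗ₘ act o (Gram A X)
Gram-◁ A X o i j = begin
  form A (λ l → colOp o (X l) i) (λ k → colOp o (X k) j)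
    ≡⟨ colOp-commutes-linear (form-linearˡ A (λ k → colOp o (X k) j)) o X i ⟩
  colOp o (λ i′ → form A (λ l → X l i′) (λ k → colOp o (X k) j)) i
    ≡⟨ colOp-cong o (λ i′ → colOp-commutes-linear (form-linearʳ A (λ l → X l i′)) o X j) i ⟩
  act o (Gram A X) i j ∎
  where open ≡-Reasoning

Gram-◁* : ∀ {n} (A X : Mat n) L → Gram A (X ◁* L) ≗ₘ act* L (Gram A X)
Gram-◁* A X []      = λ _ _ → refl
Gram-◁* A X (o ∷ L) i j = trans (Gram-◁* A (X ◁ o) L i j) (act*-cong L (Gram-◁ A X o) i j)

1ₘ-diagonal : ∀ {n} (i : Fin n) → 1ₘ i i ≡ + 1
1ₘ-diagonal zero    = refl
1ₘ-diagonal (suc i) = 1ₘ-diagonal i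

1ₘ-off-diagonal : ∀ {n} {i j : Fin n} → i ≢ j → 1ₘ i j ≡ + 0
1ₘ-off-diagonal {i = zero}  {zero}  i≢j = contradiction refl i≢j
1ₘ-off-diagonal {i = zero}  {suc j} i≢j = refl
1ₘ-off-diagonal {i = suc i} {zero}  i≢j = refl
1ₘ-off-diagonal {i = suc i} {suc j} i≢j = 1ₘ-off-diagonal (i≢j ∘ cong suc)

Gram-1ₘ : ∀ {n} (A : Mat n) → Gram A 1ₘ ≗ₘ A
Gram-1ₘ A i j = begin
  ∑ (λ k → ∑ (λ l → 1ₘ l i * A l k) * 1ₘ k j) ≡⟨ ∑-cong (λ k → cong (_* 1ₘ k j) (select-row k)) ⟩
  ∑ (λ k → A i k * 1ₘ k j)
    ≡⟨ ∑-single _ j (λ k k≢j → trans (cong (A i k *_) (1ₘ-off-diagonal k≢j)) (ℤP.*-zeroʳ (A i k))) ⟩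
  A i j * 1ₘ j j                               ≡⟨ trans (cong (A i j *_) (1ₘ-diagonal j)) (ℤP.*-identityʳ (A i j)) ⟩
  A i j                                        ∎
  where
  open ≡-Reasoning
  select-row : ∀ k → ∑ (λ l → 1ₘ l i * A l k) ≡ A i k
  select-row k = begin
    ∑ (λ l → 1ₘ l i * A l k) ≡⟨ ∑-single _ i (λ l l≢i → cong (_* A l k) (1ₘ-off-diagonal l≢i)) ⟩
    1ₘ i i * A i k           ≡⟨ trans (cong (_* A i k) (1ₘ-diagonal i)) (ℤP.*-identityˡ (A i k)) ⟩
    A i k                    ∎

infix 4 _≈₄_
_≈₄_ : ∀ {n} → Mat n → Mat n → Set
B ≈₄ C = ∀ i j → B i j ≡₄ C i j

≗ₘ⇒≈₄ : ∀ {n} {B C : Mat n} → B ≗ₘ C → B ≈₄ C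
≗ₘ⇒≈₄ B≗C i j = ≡⇒≡₄ (B≗C i j)

≈₄-trans : ∀ {n} {B C D : Mat n} → B ≈₄ C → C ≈₄ D → B ≈₄ D
≈₄-trans B≈C C≈D i j = ≡₄-trans (B≈C i j) (C≈D i j)

combine-≡₄ : ∀ {x x′ y y′} c → x ≡₄ x′ → y ≡₄ y′ → x + c * y ≡₄ x′ + c * y′
combine-≡₄ c x≡x′ y≡y′ = +-cong₄ x≡x′ (*-cong₄ {c} ≡₄-refl y≡y′)

act*-≈₄ : ∀ {n} L {B C : Mat n} → B ≈₄ C → act* L B ≈₄ act* L C
act*-≈₄ []      B≈C = B≈C
act*-≈₄ (o ∷ L) B≈C = act*-≈₄ L (act-pointwise _≡₄_ combine-≡₄ o B≈C)

AllEven : ∀ {n} → Mat n → Set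
AllEven B = ∀ i j → Even (B i j)

EvenDiag : ∀ {n} → Mat n → Set
EvenDiag B = ∀ i → Even (B i i)

combine-even : ∀ {x y} c → Even x → Even y → Even (x + c * y)
combine-even c ex ey = ℤDiv.∣m∣n⇒∣m+n ex (ℤDiv.∣n⇒∣m*n c ey)

act*-allEven : ∀ {n} L {B : Mat n} → AllEven B → AllEven (act* L B)
act*-allEven []      ev = ev
act*-allEven (o ∷ L) {B} ev = act*-allEven L (act-pointwise (λ x _ → Even x) (λ c → combine-even c) o {B} {B} ev)

act-evenDiag : ∀ {n} o {B : Mat n} → Symmetric B → EvenDiag B → EvenDiag (act o B)
act-evenDiag (addMul a p a≢p c) {B} sym-B ev i with i ≟ a
... | yes refl = subst Even (sym diagonal) (subst Even (regroup (B i i) (B i p) (B p p) c)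
      (ℤDiv.∣m∣n⇒∣m+n (ℤDiv.∣m∣n⇒∣m+n (ev i) (ℤDiv.∣n⇒∣m*n (c * B i p) ℤDiv.∣-refl)) (ℤDiv.∣n⇒∣m*n (c * c) (ev p))))
  where
  regroup : ∀ x y z c → x + c * y * + 2 + c * c * z ≡ (x + c * y) + c * (y + c * z)
  regroup = solve-∀
  o : ElemOp _
  o = addMul i p a≢p c
  diagonal : act o B i i ≡ (B i i + c * B i p) + c * (B i p + c * B p p)
  diagonal = begin
    act o B i i                                       ≡⟨ updateAt-updates i (λ k → colOp o (B k) i) ⟩
    colOp o (B i) i + c * colOp o (B p) i
      ≡⟨ cong₂ (λ x y → x + c * y) (updateAt-updates i (B i)) (updateAt-updates i (B p)) ⟩
    (B i i + c * B i p) + c * (B p i + c * B p p)     ≡⟨ cong (λ x → (B i i + c * B i p) + c * (x + c * B p p)) (sym-B p i) ⟩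
    (B i i + c * B i p) + c * (B i p + c * B p p)     ∎
    where open ≡-Reasoning
... | no i≢a = subst Even (sym (trans (updateAt-minimal i a (λ k → colOp (addMul a p a≢p c) (B k) i) i≢a)
                                      (updateAt-minimal i a (B i) i≢a))) (ev i)
act-evenDiag (swap a b) sym-B ev i = ev (transposition a b i)

act*-evenDiag : ∀ {n} L {B : Mat n} → Symmetric B → EvenDiag B → EvenDiag (act* L B)
act*-evenDiag []      sym-B ev = ev
act*-evenDiag (o ∷ L) sym-B ev = act*-evenDiag L (act-symmetric o sym-B) (act-evenDiag o sym-B ev)

infix 4 _⇝_
_⇝_ : ∀ {n} → Mat n → Mat n → Set
B ⇝ C = ∃[ L ] act* L B ≈₄ C

≈₄⇒⇝ : ∀ {n} {B C : Mat n} → B ≈₄ C → B ⇝ C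
≈₄⇒⇝ B≈C = [] , B≈C

≗ₘ⇒⇝ : ∀ {n} {B C : Mat n} → B ≗ₘ C → B ⇝ C
≗ₘ⇒⇝ B≗C = ≈₄⇒⇝ (≗ₘ⇒≈₄ B≗C)

⇝-trans : ∀ {n} {B C D : Mat n} → B ⇝ C → C ⇝ D → B ⇝ D
⇝-trans {B = B} {C} {D} (L , BL≈C) (L′ , CL′≈D) = L ++ L′ , λ i j → begin
  act* (L ++ L′) B i j   ≡⟨ cong (λ M → M i j) (act*-++ L L′ B) ⟩
  act* L′ (act* L B) i j ≈⟨ act*-≈₄ L′ BL≈C i j ⟩
  act* L′ C i j          ≈⟨ CL′≈D i j ⟩
  D i j                  ∎
  where open ≡₄-Reasoning

≗ₘ-isEquivalence : ∀ {n} → IsEquivalence (_≗ₘ_ {n})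
≗ₘ-isEquivalence = record
  { refl = λ _ _ → refl
  ; sym = ≗ₘ-sym
  ; trans = λ B≗C C≗D i j → trans (B≗C i j) (C≗D i j)
  }

⇝-isPreorder : ∀ {n} → IsPreorder (_≗ₘ_ {n}) _⇝_
⇝-isPreorder = record { isEquivalence = ≗ₘ-isEquivalence ; reflexive = ≗ₘ⇒⇝ ; trans = ⇝-trans }

⇝-preorder : ℕ → Preorder _ _ _
⇝-preorder n = record { isPreorder = ⇝-isPreorder {n} }

module ⇝-Reasoning {n} = PreorderReasoning (⇝-preorder n)

-- Block sums

lift : ∀ {n} → ElemOp n → ElemOp (suc n)
lift (addMul a p a≢p c) = addMul (suc a) (suc p) (a≢p ∘ FinP.suc-injective) c
lift (swap a b)         = swap (suc a) (suc b)

transposition-suc : ∀ {n} (a b j : Fin n) → transposition (suc a) (suc b) (suc j) ≡ suc (transposition a b j)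
transposition-suc a b j with j ≟ a
... | yes _ = refl
... | no _ with j ≟ b
...   | yes _ = refl
...   | no _  = refl

colOp-lift-zero : ∀ {n} o (v : Vector ℤ (suc n)) → colOp (lift o) v zero ≡ v zero
colOp-lift-zero (addMul a p _ c) v = refl
colOp-lift-zero (swap a b)       v = refl

colOp-lift-suc : ∀ {n} o (v : Vector ℤ (suc n)) j → colOp (lift o) v (suc j) ≡ colOp o (v ∘ suc) j
colOp-lift-suc (addMul a p _ c) v j = refl
colOp-lift-suc (swap a b)       v j = cong v (transposition-suc a b j)

colOp* : ∀ {n} → List (ElemOp n) → Vector ℤ n → Vector ℤ n
colOp* L v = foldl (λ w o → colOp o w) v L

colOp*-cong : ∀ {n} L {u v : Vector ℤ n} → u ≗ v → colOp* L u ≗ colOp* L v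
colOp*-cong []      u≗v = u≗v
colOp*-cong (o ∷ L) u≗v = colOp*-cong L (colOp-cong o u≗v)

colOp*-lift : ∀ {n} L (v : Vector ℤ (suc n)) → colOp* (map lift L) v ≗ (v zero ∷ᵥ colOp* L (v ∘ suc))
colOp*-lift []      v zero    = refl
colOp*-lift []      v (suc j) = refl
colOp*-lift (o ∷ L) v zero    = trans (colOp*-lift L (colOp (lift o) v) zero) (colOp-lift-zero o v)
colOp*-lift (o ∷ L) v (suc j) = trans (colOp*-lift L (colOp (lift o) v) (suc j)) (colOp*-cong L (colOp-lift-suc o v) j)

colOp*-zero : ∀ {n} L (j : Fin n) → colOp* L (λ _ → + 0) j ≡ + 0
colOp*-zero L = go L (λ _ → refl)
  where
  combine-zero : ∀ {x y} c → x ≡ + 0 → y ≡ + 0 → x + c * y ≡ + 0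
  combine-zero c refl refl = trans (ℤP.+-identityˡ (c * + 0)) (ℤP.*-zeroʳ c)
  go : ∀ {n} L {v : Vector ℤ n} → (∀ k → v k ≡ + 0) → ∀ j → colOp* L v j ≡ + 0
  go []      v≡0 = v≡0
  go (o ∷ L) {v} v≡0 = go L (colOp-pointwise (λ x _ → x ≡ + 0) (λ c → combine-zero c) o {v} {v} v≡0)

border : ∀ {m} → ℤ → Vector ℤ m → Mat m → Mat (suc m)
border c v R zero    zero    = c
border c v R zero    (suc j) = v j
border c v R (suc i) zero    = v i
border c v R (suc i) (suc j) = R i j

border-≈₄ : ∀ {m} {c c′} {v v′ : Vector ℤ m} {R R′} → c ≡₄ c′ → (∀ j → v j ≡₄ v′ j) → R ≈₄ R′ →
  border c v R ≈₄ border c′ v′ R′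
border-≈₄ c≡c′ v≡v′ R≈R′ zero    zero    = c≡c′
border-≈₄ c≡c′ v≡v′ R≈R′ zero    (suc j) = v≡v′ j
border-≈₄ c≡c′ v≡v′ R≈R′ (suc i) zero    = v≡v′ i
border-≈₄ c≡c′ v≡v′ R≈R′ (suc i) (suc j) = R≈R′ i j

act-lift-border : ∀ {m} o c (v : Vector ℤ m) R → act (lift o) (border c v R) ≗ₘ border c (colOp o v) (act o R)
act-lift-border o c v R zero zero =
  trans (colOp-lift-zero o _) (colOp-lift-zero o (border c v R zero))
act-lift-border o c v R zero (suc j) =
  trans (colOp-lift-zero o _) (colOp-lift-suc o (border c v R zero) j)
act-lift-border o c v R (suc i) zero =
  trans (colOp-lift-suc o _ i) (colOp-cong o (λ k → colOp-lift-zero o (border c v R (suc k))) i)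
act-lift-border o c v R (suc i) (suc j) =
  trans (colOp-lift-suc o _ i) (colOp-cong o (λ k → colOp-lift-suc o (border c v R (suc k)) j) i)

act*-lift-border : ∀ {m} L c (v : Vector ℤ m) R → act* (map lift L) (border c v R) ≗ₘ border c (colOp* L v) (act* L R)
act*-lift-border []      c v R = border-refl
  where
  border-refl : border c v R ≗ₘ border c v R
  border-refl _ _ = refl
act*-lift-border (o ∷ L) c v R i j =
  trans (act*-cong (map lift L) (act-lift-border o c v R) i j) (act*-lift-border L c (colOp o v) (act o R) i j)

infixr 5 _⊕_ _⊕₂_
_⊕_ : ∀ {m} → ℤ → Mat m → Mat (suc m)
d ⊕ R = border d (λ _ → + 0) R

record Sym₂ : Set where
  constructor sym₂
  field
    diag₀ off diag₁ : ℤ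

_⊕₂_ : ∀ {m} → Sym₂ → Mat m → Mat (2 ℕ.+ m)
sym₂ a b c ⊕₂ R = border a (b ∷ᵥ λ _ → + 0) (c ⊕ R)

E H T : Sym₂
E = sym₂ (+ 2) (+ 1) (+ 2)
H = sym₂ (+ 0) (+ 1) (+ 0)
T = sym₂ (+ 0) (+ 2) (+ 0)

act*-lift-⊕ : ∀ {m} L d {R R′ : Mat m} → act* L R ≈₄ R′ → act* (map lift L) (d ⊕ R) ≈₄ d ⊕ R′
act*-lift-⊕ L d {R} RL≈R′ = ≈₄-trans (≗ₘ⇒≈₄ (act*-lift-border L d (λ _ → + 0) R))
  (border-≈₄ ≡₄-refl (λ j → ≡⇒≡₄ (colOp*-zero L j)) RL≈R′)

⊕-cong : ∀ {m} d {R R′ : Mat m} → R ⇝ R′ → d ⊕ R ⇝ d ⊕ R′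
⊕-cong d (L , RL≈R′) = map lift L , act*-lift-⊕ L d RL≈R′

⊕₂-cong : ∀ {m} X {R R′ : Mat m} → R ⇝ R′ → X ⊕₂ R ⇝ X ⊕₂ R′
⊕₂-cong (sym₂ a b c) {R} (L , RL≈R′) = map lift (map lift L) , ≈₄-trans
  (≗ₘ⇒≈₄ (act*-lift-border (map lift L) a (b ∷ᵥ λ _ → + 0) (c ⊕ R)))
  (border-≈₄ ≡₄-refl first-row (act*-lift-⊕ L c RL≈R′))
  where
  first-row : ∀ j → colOp* (map lift L) (b ∷ᵥ λ _ → + 0) j ≡₄ (b ∷ᵥ λ _ → + 0) j
  first-row zero    = ≡⇒≡₄ (colOp*-lift L _ zero)
  first-row (suc j) = ≡⇒≡₄ (trans (colOp*-lift L _ (suc j)) (colOp*-zero L j))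

⊕₂-swap : ∀ {m} X Y (R : Mat m) → X ⊕₂ Y ⊕₂ R ⇝ Y ⊕₂ X ⊕₂ R
⊕₂-swap X Y R = swapBlocks , swapped
  where
  swapBlocks : List (ElemOp (4 ℕ.+ _))
  swapBlocks = swap zero (suc (suc zero)) ∷ swap (suc zero) (suc (suc (suc zero))) ∷ []
  swapped : act* swapBlocks (X ⊕₂ Y ⊕₂ R) ≈₄ Y ⊕₂ X ⊕₂ R
  swapped zero                            zero                            = ≡₄-refl
  swapped zero                            (suc zero)                      = ≡₄-refl
  swapped zero                            (suc (suc zero))                = ≡₄-refl
  swapped zero                            (suc (suc (suc zero)))          = ≡₄-refl
  swapped zero                            (suc (suc (suc (suc j))))       = ≡₄-refl
  swapped (suc zero)                      zero                            = ≡₄-refl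
  swapped (suc zero)                      (suc zero)                      = ≡₄-refl
  swapped (suc zero)                      (suc (suc zero))                = ≡₄-refl
  swapped (suc zero)                      (suc (suc (suc zero)))          = ≡₄-refl
  swapped (suc zero)                      (suc (suc (suc (suc j))))       = ≡₄-refl
  swapped (suc (suc zero))                zero                            = ≡₄-refl
  swapped (suc (suc zero))                (suc zero)                      = ≡₄-refl
  swapped (suc (suc zero))                (suc (suc zero))                = ≡₄-refl
  swapped (suc (suc zero))                (suc (suc (suc zero)))          = ≡₄-refl
  swapped (suc (suc zero))                (suc (suc (suc (suc j))))       = ≡₄-refl
  swapped (suc (suc (suc zero)))          zero                            = ≡₄-refl
  swapped (suc (suc (suc zero)))          (suc zero)                      = ≡₄-refl
  swapped (suc (suc (suc zero)))          (suc (suc zero))                = ≡₄-refl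
  swapped (suc (suc (suc zero)))          (suc (suc (suc zero)))          = ≡₄-refl
  swapped (suc (suc (suc zero)))          (suc (suc (suc (suc j))))       = ≡₄-refl
  swapped (suc (suc (suc (suc i))))       zero                            = ≡₄-refl
  swapped (suc (suc (suc (suc i))))       (suc zero)                      = ≡₄-refl
  swapped (suc (suc (suc (suc i))))       (suc (suc zero))                = ≡₄-refl
  swapped (suc (suc (suc (suc i))))       (suc (suc (suc zero)))          = ≡₄-refl
  swapped (suc (suc (suc (suc i))))       (suc (suc (suc (suc j))))       = ≡₄-refl

2⊕T⇝2⊕2⊕2 : ∀ {m} (R : Mat m) → + 2 ⊕ T ⊕₂ R ⇝ + 2 ⊕ + 2 ⊕ + 2 ⊕ R
2⊕T⇝2⊕2⊕2 R = diagonalise , diagonalised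
  where
  diagonalise : List (ElemOp (3 ℕ.+ _))
  diagonalise = addMul zero (suc zero) (λ ()) (+ 1) ∷ addMul (suc (suc zero)) zero (λ ()) (+ 1)
              ∷ addMul (suc zero) (suc (suc zero)) (λ ()) (+ 1) ∷ []
  diagonalised : act* diagonalise (+ 2 ⊕ T ⊕₂ R) ≈₄ + 2 ⊕ + 2 ⊕ + 2 ⊕ R
  diagonalised zero                    zero                    = mk≡₄ refl
  diagonalised zero                    (suc zero)              = mk≡₄ refl
  diagonalised zero                    (suc (suc zero))        = mk≡₄ refl
  diagonalised zero                    (suc (suc (suc j)))     = mk≡₄ refl
  diagonalised (suc zero)              zero                    = mk≡₄ refl
  diagonalised (suc zero)              (suc zero)              = mk≡₄ refl
  diagonalised (suc zero)              (suc (suc zero))        = mk≡₄ refl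
  diagonalised (suc zero)              (suc (suc (suc j)))     = mk≡₄ refl
  diagonalised (suc (suc zero))        zero                    = mk≡₄ refl
  diagonalised (suc (suc zero))        (suc zero)              = mk≡₄ refl
  diagonalised (suc (suc zero))        (suc (suc zero))        = mk≡₄ refl
  diagonalised (suc (suc zero))        (suc (suc (suc j)))     = mk≡₄ refl
  diagonalised (suc (suc (suc i)))     zero                    = mk≡₄ refl
  diagonalised (suc (suc (suc i)))     (suc zero)              = mk≡₄ refl
  diagonalised (suc (suc (suc i)))     (suc (suc zero))        = mk≡₄ refl
  diagonalised (suc (suc (suc i)))     (suc (suc (suc j)))     = mk≡₄ refl

0ₘ : ∀ {n} → Mat n
0ₘ _ _ = + 0

NF : ℕ → ℕ → ℕ → ℕ → ℕ → ∀ {n} → Mat n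
NF r s t p m i j = + N r s t p m i j

-- Nentry with the lengths 2r, 2s, 2t of its runs of 2×2 blocks abstracted, so that a block can be
-- split off the front of a run by pattern matching.
pairRun : ℕ → ℕ → ℕ → (ℕ → ℕ → ℕ) → ℕ → ℕ → ℕ
pairRun K d o rest i j =
  if i <ᵇ K then (if j <ᵇ K then pairEntry d o i j else 0)
  else (if j <ᵇ K then 0 else rest (i ∸ K) (j ∸ K))

diagRun : ℕ → ℕ → ℕ → ℕ
diagRun p i j = if i ≡ᵇ j then (if i <ᵇ p then 2 else 0) else 0

Nentry-runs : ∀ r s t p m i j →
  Nentry r s t p m i j ≡ pairRun (2 ℕ.* r) 2 1 (pairRun (2 ℕ.* s) 0 1 (pairRun (2 ℕ.* t) 0 2 (diagRun p))) i j
Nentry-runs r s t p m i j = refl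

if-zero : ∀ b {v : ℕ} → v ≡ 0 → (if b then v else 0) ≡ 0
if-zero true  v≡0 = v≡0
if-zero false _   = refl

[2+m]/2≡1+m/2 : ∀ m → (2 ℕ.+ m) ℕ./ 2 ≡ suc (m ℕ./ 2)
[2+m]/2≡1+m/2 m = ℕD.m/n≡1+[m∸n]/n {2 ℕ.+ m} {2} (s≤s (s≤s z≤n))

pairEntry-shift : ∀ d o i j → pairEntry d o (2 ℕ.+ i) (2 ℕ.+ j) ≡ pairEntry d o i j
pairEntry-shift d o i j =
  cong₂ (λ a b → if a ≡ᵇ b then (if i ≡ᵇ j then d else o) else 0) ([2+m]/2≡1+m/2 i) ([2+m]/2≡1+m/2 j)

pairEntry-apart : ∀ d o {i} j → i ℕ.< 2 → pairEntry d o i (2 ℕ.+ j) ≡ 0 × pairEntry d o (2 ℕ.+ j) i ≡ 0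
pairEntry-apart d o {0} j _ = cong (λ b → if 0 ≡ᵇ b then o else 0) ([2+m]/2≡1+m/2 j)
                            , cong (λ b → if b ≡ᵇ 0 then o else 0) ([2+m]/2≡1+m/2 j)
pairEntry-apart d o {1} j _ = cong (λ b → if 0 ≡ᵇ b then (if 1 ≡ᵇ 2 ℕ.+ j then d else o) else 0) ([2+m]/2≡1+m/2 j)
                            , cong (λ b → if b ≡ᵇ 0 then (if 2 ℕ.+ j ≡ᵇ 1 then d else o) else 0) ([2+m]/2≡1+m/2 j)
pairEntry-apart d o {suc (suc _)} j (s≤s (s≤s ()))

pairRun-⊕₂ : ∀ {k} K d o rest →
  (λ (i j : Fin (2 ℕ.+ k)) → + pairRun (2 ℕ.+ K) d o rest (toℕ i) (toℕ j))
    ≗ₘ sym₂ (+ d) (+ o) (+ d) ⊕₂ (λ i j → + pairRun K d o rest (toℕ i) (toℕ j))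
pairRun-⊕₂ K d o rest zero             zero             = refl
pairRun-⊕₂ K d o rest zero             (suc zero)       = refl
pairRun-⊕₂ K d o rest (suc zero)       zero             = refl
pairRun-⊕₂ K d o rest (suc zero)       (suc zero)       = refl
pairRun-⊕₂ K d o rest zero             (suc (suc j))    = cong +_ (if-zero (toℕ j <ᵇ K) (proj₁ (pairEntry-apart d o (toℕ j) (s≤s z≤n))))
pairRun-⊕₂ K d o rest (suc zero)       (suc (suc j))    = cong +_ (if-zero (toℕ j <ᵇ K) (proj₁ (pairEntry-apart d o (toℕ j) (s≤s (s≤s z≤n)))))
pairRun-⊕₂ K d o rest (suc (suc i))    zero             = cong +_ (if-zero (toℕ i <ᵇ K) (proj₂ (pairEntry-apart d o (toℕ i) (s≤s z≤n))))
pairRun-⊕₂ K d o rest (suc (suc i))    (suc zero)       = cong +_ (if-zero (toℕ i <ᵇ K) (proj₂ (pairEntry-apart d o (toℕ i) (s≤s (s≤s z≤n)))))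
pairRun-⊕₂ K d o rest (suc (suc i))    (suc (suc j))    =
  cong (λ e → + (if toℕ i <ᵇ K then (if toℕ j <ᵇ K then e else 0) else (if toℕ j <ᵇ K then 0 else rest (toℕ i ∸ K) (toℕ j ∸ K))))
       (pairEntry-shift d o (toℕ i) (toℕ j))

NF-E : ∀ {k} r s t p m → NF (suc r) s t p m {2 ℕ.+ k} ≗ₘ E ⊕₂ NF r s t p m
NF-E r s t p m i j = trans (cong +_ (Nentry-runs (suc r) s t p m (toℕ i) (toℕ j)))
  (trans (cong (λ K → + pairRun K 2 1 rest (toℕ i) (toℕ j)) (ℕP.*-suc 2 r)) (pairRun-⊕₂ (2 ℕ.* r) 2 1 rest i j))
  where rest = pairRun (2 ℕ.* s) 0 1 (pairRun (2 ℕ.* t) 0 2 (diagRun p))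

NF-H : ∀ {k} s t p m → NF 0 (suc s) t p m {2 ℕ.+ k} ≗ₘ H ⊕₂ NF 0 s t p m
NF-H s t p m i j = trans (cong (λ K → + pairRun K 0 1 rest (toℕ i) (toℕ j)) (ℕP.*-suc 2 s)) (pairRun-⊕₂ (2 ℕ.* s) 0 1 rest i j)
  where rest = pairRun (2 ℕ.* t) 0 2 (diagRun p)

NF-T : ∀ {k} t p m → NF 0 0 (suc t) p m {2 ℕ.+ k} ≗ₘ T ⊕₂ NF 0 0 t p m
NF-T t p m i j = trans (cong (λ K → + pairRun K 0 2 (diagRun p) (toℕ i) (toℕ j)) (ℕP.*-suc 2 t))
  (pairRun-⊕₂ (2 ℕ.* t) 0 2 (diagRun p) i j)

NF-2 : ∀ {k} p m → NF 0 0 0 (suc p) m {suc k} ≗ₘ + 2 ⊕ NF 0 0 0 p m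
NF-2 p m zero    zero    = refl
NF-2 p m zero    (suc j) = refl
NF-2 p m (suc i) zero    = refl
NF-2 p m (suc i) (suc j) = refl

NF-0 : ∀ {k} m → NF 0 0 0 0 m {k} ≗ₘ 0ₘ
NF-0 m i j = cong +_ (if-zero (toℕ i ≡ᵇ toℕ j) (if-zero (toℕ i <ᵇ 0) refl))

N<4 : ∀ r s t p m {n} (i j : Fin n) → N r s t p m i j ℕ.< 4
N<4 r s t p m i j =
  pairRun<4 (2 ℕ.* r) 2 1 (pairRun<4 (2 ℕ.* s) 0 1 (pairRun<4 (2 ℕ.* t) 0 2 diagRun<4 0<4 2<4) 0<4 1<4) 2<4 1<4 (toℕ i) (toℕ j)
  where
  0<4 : 0 ℕ.< 4
  0<4 = s≤s z≤n
  1<4 : 1 ℕ.< 4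
  1<4 = s≤s (s≤s z≤n)
  2<4 : 2 ℕ.< 4
  2<4 = s≤s (s≤s (s≤s z≤n))
  if<4 : ∀ b {x y} → x ℕ.< 4 → y ℕ.< 4 → (if b then x else y) ℕ.< 4
  if<4 true  x<4 _   = x<4
  if<4 false _   y<4 = y<4
  diagRun<4 : ∀ i j → diagRun p i j ℕ.< 4
  diagRun<4 i j = if<4 (i ≡ᵇ j) (if<4 (i <ᵇ p) 2<4 0<4) 0<4
  pairRun<4 : ∀ K d o {rest} → (∀ i j → rest i j ℕ.< 4) → d ℕ.< 4 → o ℕ.< 4 → ∀ i j → pairRun K d o rest i j ℕ.< 4
  pairRun<4 K d o rest<4 d<4 o<4 i j = if<4 (i <ᵇ K)
    (if<4 (j <ᵇ K) (if<4 ((i ℕ./ 2) ≡ᵇ (j ℕ./ 2)) (if<4 (i ≡ᵇ j) d<4 o<4) 0<4) 0<4)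
    (if<4 (j <ᵇ K) 0<4 (rest<4 (i ∸ K) (j ∸ K)))

record NormalForm {n} (B : Mat n) : Set where
  constructor normalForm
  field
    r s t p m : ℕ
    size      : 2 ℕ.* r ℕ.+ 2 ℕ.* s ℕ.+ 2 ℕ.* t ℕ.+ p ℕ.+ m ≡ n
    reduces   : B ⇝ NF r s t p m

record EvenNormalForm {n} (B : Mat n) : Set where
  constructor evenNormalForm
  field
    t p m   : ℕ
    size    : 2 ℕ.* t ℕ.+ p ℕ.+ m ≡ n
    reduces : B ⇝ NF 0 0 t p m

EvenNormalForm⇒NormalForm : ∀ {n} {B : Mat n} → EvenNormalForm B → NormalForm B
EvenNormalForm⇒NormalForm (evenNormalForm t p m size reduces) = normalForm 0 0 t p m size reduces

NormalForm-⇝ : ∀ {n} {B C : Mat n} → B ⇝ C → NormalForm C → NormalForm B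
NormalForm-⇝ B⇝C (normalForm r s t p m size C⇝N) = normalForm r s t p m size (⇝-trans B⇝C C⇝N)

EvenNormalForm-⇝ : ∀ {n} {B C : Mat n} → B ⇝ C → EvenNormalForm C → EvenNormalForm B
EvenNormalForm-⇝ B⇝C (evenNormalForm t p m size C⇝N) = evenNormalForm t p m size (⇝-trans B⇝C C⇝N)

zero-EvenNormalForm : ∀ {n} {B : Mat n} → B ≈₄ 0ₘ → EvenNormalForm B
zero-EvenNormalForm {n} B≈0 = evenNormalForm 0 0 n refl (≈₄⇒⇝ (≈₄-trans B≈0 (≗ₘ⇒≈₄ (≗ₘ-sym (NF-0 n)))))

-- The bound leaves room for the leading E blocks of NF r s t p m.
H⊕NF⇝NF : ∀ {k} r s t p m → 2 ℕ.* r ℕ.≤ k → H ⊕₂ NF r s t p m {k} ⇝ NF r (suc s) t p m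
H⊕NF⇝NF zero s t p m _ = ≗ₘ⇒⇝ (≗ₘ-sym (NF-H s t p m))
H⊕NF⇝NF {k} (suc r) s t p m 2r+2≤k with subst (ℕ._≤ k) (ℕP.*-suc 2 r) 2r+2≤k
... | s≤s (s≤s 2r≤k′) = begin
  H ⊕₂ NF (suc r) s t p m        ∼⟨ ⊕₂-cong H (≗ₘ⇒⇝ (NF-E r s t p m)) ⟩
  H ⊕₂ E ⊕₂ NF r s t p m         ∼⟨ ⊕₂-swap H E _ ⟩
  E ⊕₂ H ⊕₂ NF r s t p m         ∼⟨ ⊕₂-cong E (H⊕NF⇝NF r s t p m 2r≤k′) ⟩
  E ⊕₂ NF r (suc s) t p m        ≈⟨ ≗ₘ-sym (NF-E r (suc s) t p m) ⟩
  NF (suc r) (suc s) t p m       ∎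
  where open ⇝-Reasoning

3+[2t+p]≡1+[2[1+t]+p] : ∀ t p → 3 ℕ.+ (2 ℕ.* t ℕ.+ p) ≡ 1 ℕ.+ (2 ℕ.* suc t ℕ.+ p)
3+[2t+p]≡1+[2[1+t]+p] = ℕSolver.solve-∀

2⊕NF⇝NF : ∀ {k} t p m → 2 ℕ.* t ℕ.≤ k → + 2 ⊕ NF 0 0 t p m {k} ⇝ NF 0 0 0 (suc (2 ℕ.* t ℕ.+ p)) m
2⊕NF⇝NF zero p m _ = ≗ₘ⇒⇝ (≗ₘ-sym (NF-2 p m))
2⊕NF⇝NF {k} (suc t) p m 2t+2≤k with subst (ℕ._≤ k) (ℕP.*-suc 2 t) 2t+2≤k
... | s≤s (s≤s 2t≤k′) = begin
  + 2 ⊕ NF 0 0 (suc t) p m                       ∼⟨ ⊕-cong (+ 2) (≗ₘ⇒⇝ (NF-T t p m)) ⟩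
  + 2 ⊕ T ⊕₂ NF 0 0 t p m                        ∼⟨ 2⊕T⇝2⊕2⊕2 _ ⟩
  + 2 ⊕ + 2 ⊕ + 2 ⊕ NF 0 0 t p m                 ∼⟨ ⊕-cong (+ 2) (⊕-cong (+ 2) (2⊕NF⇝NF t p m 2t≤k′)) ⟩
  + 2 ⊕ + 2 ⊕ NF 0 0 0 (suc q) m                 ∼⟨ ⊕-cong (+ 2) (≗ₘ⇒⇝ (≗ₘ-sym (NF-2 (suc q) m))) ⟩
  + 2 ⊕ NF 0 0 0 (suc (suc q)) m                 ≈⟨ ≗ₘ-sym (NF-2 (suc (suc q)) m) ⟩
  NF 0 0 0 (suc (suc (suc q))) m                 ≡⟨ cong (λ p′ → NF 0 0 0 p′ m) (3+[2t+p]≡1+[2[1+t]+p] t p) ⟩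
  NF 0 0 0 (suc (2 ℕ.* suc t ℕ.+ p)) m           ∎
  where
  open ⇝-Reasoning
  q : ℕ
  q = 2 ℕ.* t ℕ.+ p

2r+2[1+s]+2t+p+m≡2+[2r+2s+2t+p+m] : ∀ r s t p m →
  2 ℕ.* r ℕ.+ 2 ℕ.* suc s ℕ.+ 2 ℕ.* t ℕ.+ p ℕ.+ m ≡ 2 ℕ.+ (2 ℕ.* r ℕ.+ 2 ℕ.* s ℕ.+ 2 ℕ.* t ℕ.+ p ℕ.+ m)
2r+2[1+s]+2t+p+m≡2+[2r+2s+2t+p+m] = ℕSolver.solve-∀

E⊕-NormalForm : ∀ {k} {R : Mat k} → NormalForm R → NormalForm (E ⊕₂ R)
E⊕-NormalForm {k} {R} (normalForm r s t p m size R⇝N) = normalForm (suc r) s t p m size′ (begin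
  E ⊕₂ R               ∼⟨ ⊕₂-cong E R⇝N ⟩
  E ⊕₂ NF r s t p m    ≈⟨ ≗ₘ-sym (NF-E r s t p m) ⟩
  NF (suc r) s t p m   ∎)
  where
  open ⇝-Reasoning
  size′ : 2 ℕ.* suc r ℕ.+ 2 ℕ.* s ℕ.+ 2 ℕ.* t ℕ.+ p ℕ.+ m ≡ 2 ℕ.+ k
  size′ = trans (cong (λ a → a ℕ.+ 2 ℕ.* s ℕ.+ 2 ℕ.* t ℕ.+ p ℕ.+ m) (ℕP.*-suc 2 r)) (cong (2 ℕ.+_) size)

H⊕-NormalForm : ∀ {k} {R : Mat k} → NormalForm R → NormalForm (H ⊕₂ R)
H⊕-NormalForm {k} {R} (normalForm r s t p m size R⇝N) = normalForm r (suc s) t p m size′ (begin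
  H ⊕₂ R               ∼⟨ ⊕₂-cong H R⇝N ⟩
  H ⊕₂ NF r s t p m    ∼⟨ H⊕NF⇝NF r s t p m 2r≤k ⟩
  NF r (suc s) t p m   ∎)
  where
  open ⇝-Reasoning
  size′ : 2 ℕ.* r ℕ.+ 2 ℕ.* suc s ℕ.+ 2 ℕ.* t ℕ.+ p ℕ.+ m ≡ 2 ℕ.+ k
  size′ = trans (2r+2[1+s]+2t+p+m≡2+[2r+2s+2t+p+m] r s t p m) (cong (2 ℕ.+_) size)
  2r≤k : 2 ℕ.* r ℕ.≤ k
  2r≤k = subst (2 ℕ.* r ℕ.≤_) size
    (ℕP.≤-trans (ℕP.m≤m+n _ _) (ℕP.≤-trans (ℕP.m≤m+n _ _) (ℕP.≤-trans (ℕP.m≤m+n _ _) (ℕP.m≤m+n _ m))))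

T⊕-EvenNormalForm : ∀ {k} {R : Mat k} → EvenNormalForm R → EvenNormalForm (T ⊕₂ R)
T⊕-EvenNormalForm {k} {R} (evenNormalForm t p m size R⇝N) = evenNormalForm (suc t) p m size′ (begin
  T ⊕₂ R                ∼⟨ ⊕₂-cong T R⇝N ⟩
  T ⊕₂ NF 0 0 t p m     ≈⟨ ≗ₘ-sym (NF-T t p m) ⟩
  NF 0 0 (suc t) p m    ∎)
  where
  open ⇝-Reasoning
  size′ : 2 ℕ.* suc t ℕ.+ p ℕ.+ m ≡ 2 ℕ.+ k
  size′ = trans (cong (λ a → a ℕ.+ p ℕ.+ m) (ℕP.*-suc 2 t)) (cong (2 ℕ.+_) size)

2⊕-EvenNormalForm : ∀ {k} {R : Mat k} → EvenNormalForm R → EvenNormalForm (+ 2 ⊕ R)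
2⊕-EvenNormalForm {R = R} (evenNormalForm t p m size R⇝N) = evenNormalForm 0 (suc (2 ℕ.* t ℕ.+ p)) m (cong suc size) (begin
  + 2 ⊕ R                                ∼⟨ ⊕-cong (+ 2) R⇝N ⟩
  + 2 ⊕ NF 0 0 t p m
    ∼⟨ 2⊕NF⇝NF t p m (subst (2 ℕ.* t ℕ.≤_) size (ℕP.≤-trans (ℕP.m≤m+n _ p) (ℕP.m≤m+n _ m))) ⟩
  NF 0 0 0 (suc (2 ℕ.* t ℕ.+ p)) m       ∎)
  where open ⇝-Reasoning

-- Splitting off a block

act-addMul-row : ∀ {n} {a p : Fin n} (a≢p : a ≢ p) c (C : Mat n) {r} → r ≢ a →
  act (addMul a p a≢p c) C r ≗ colOp (addMul a p a≢p c) (C r)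
act-addMul-row {a = a} a≢p c C {r} r≢a y = updateAt-minimal r a (λ k → colOp (addMul a _ a≢p c) (C k) y) r≢a

1+i≢0 : ∀ {m} {i : Fin m} → suc i ≢ zero
1+i≢0 ()

2+i≢1 : ∀ {m} {i : Fin m} → _≢_ {A = Fin (2 ℕ.+ m)} (suc (suc i)) (suc zero)
2+i≢1 ()

-- Clearing column c changes only row and column c, so the coefficients κ can be chosen in advance
-- from the original matrix.
clearOps₁ : ∀ {j m} → (Fin j → Fin m) → (Fin j → ℤ) → List (ElemOp (suc m))
clearOps₁ {zero}  g κ = []
clearOps₁ {suc j} g κ = addMul (suc (g zero)) zero 1+i≢0 (κ zero) ∷ clearOps₁ (g ∘ suc) (κ ∘ suc)

clearOps₁-row₀ : ∀ {j m} (g : Fin j → Fin m) κ (C : Mat (suc m)) → act* (clearOps₁ g κ) C zero ≗ colOp* (clearOps₁ g κ) (C zero)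
clearOps₁-row₀ {zero}  g κ C y = refl
clearOps₁-row₀ {suc j} g κ C y = clearOps₁-row₀ (g ∘ suc) (κ ∘ suc) (act (addMul (suc (g zero)) zero 1+i≢0 (κ zero)) C) y

clearOps₁-untouched : ∀ {j m} (g : Fin j → Fin m) κ (v : Vector ℤ (suc m)) x →
  (∀ k → x ≢ suc (g k)) → colOp* (clearOps₁ g κ) v x ≡ v x
clearOps₁-untouched {zero}  g κ v x _   = refl
clearOps₁-untouched {suc j} g κ v x x∉g = trans
  (clearOps₁-untouched (g ∘ suc) (κ ∘ suc) (colOp (addMul (suc (g zero)) zero 1+i≢0 (κ zero)) v) x (x∉g ∘ suc))
  (updateAt-minimal x (suc (g zero)) v (x∉g zero))

clearOps₁-cleared : ∀ {j m} (g : Fin j → Fin m) → Injective _≡_ _≡_ g → ∀ κ (v : Vector ℤ (suc m)) k →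
  colOp* (clearOps₁ g κ) v (suc (g k)) ≡ v (suc (g k)) + κ k * v zero
clearOps₁-cleared {suc j} g g-inj κ v zero = trans
  (clearOps₁-untouched (g ∘ suc) (κ ∘ suc) (colOp (addMul (suc (g zero)) zero 1+i≢0 (κ zero)) v) (suc (g zero))
    (λ k e → FinP.0≢1+n (g-inj (FinP.suc-injective e))))
  (updateAt-updates (suc (g zero)) v)
clearOps₁-cleared {suc j} g g-inj κ v (suc k) = trans
  (clearOps₁-cleared (g ∘ suc) (FinP.suc-injective ∘ g-inj) (κ ∘ suc) (colOp (addMul (suc (g zero)) zero 1+i≢0 (κ zero)) v) k)
  (cong (λ x → x + κ (suc k) * v zero) (updateAt-minimal (suc (g (suc k))) (suc (g zero)) v (λ e → 1+i≢0 (g-inj (FinP.suc-injective e)))))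

clearOps₂ : ∀ {j m} → (Fin j → Fin m) → (Fin j → ℤ × ℤ) → List (ElemOp (2 ℕ.+ m))
clearOps₂ {zero}  g κ = []
clearOps₂ {suc j} g κ =
  addMul (suc (suc (g zero))) zero 1+i≢0 (proj₁ (κ zero)) ∷
  addMul (suc (suc (g zero))) (suc zero) 2+i≢1 (proj₂ (κ zero)) ∷ clearOps₂ (g ∘ suc) (κ ∘ suc)

clearOps₂-row : ∀ {j m} (g : Fin j → Fin m) κ (C : Mat (2 ℕ.+ m)) r → (∀ {c} → r ≢ suc (suc c)) →
  act* (clearOps₂ g κ) C r ≗ colOp* (clearOps₂ g κ) (C r)
clearOps₂-row {zero}  g κ C r _ y = refl
clearOps₂-row {suc j} g κ C r r≢col y = trans (clearOps₂-row (g ∘ suc) (κ ∘ suc) (act o₂ (act o₁ C)) r r≢col y)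
  (colOp*-cong (clearOps₂ (g ∘ suc) (κ ∘ suc))
    (λ y′ → trans (act-addMul-row 2+i≢1 (proj₂ (κ zero)) (act o₁ C) r≢col y′)
                  (colOp-cong o₂ (act-addMul-row 1+i≢0 (proj₁ (κ zero)) C r≢col) y′)) y)
  where
  o₁ o₂ : ElemOp (2 ℕ.+ _)
  o₁ = addMul (suc (suc (g zero))) zero 1+i≢0 (proj₁ (κ zero))
  o₂ = addMul (suc (suc (g zero))) (suc zero) 2+i≢1 (proj₂ (κ zero))

clearOps₂-untouched : ∀ {j m} (g : Fin j → Fin m) κ (v : Vector ℤ (2 ℕ.+ m)) x →
  (∀ k → x ≢ suc (suc (g k))) → colOp* (clearOps₂ g κ) v x ≡ v x
clearOps₂-untouched {zero}  g κ v x _   = refl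
clearOps₂-untouched {suc j} g κ v x x∉g = begin
  colOp* (clearOps₂ (g ∘ suc) (κ ∘ suc)) (colOp o₂ (colOp o₁ v)) x
    ≡⟨ clearOps₂-untouched (g ∘ suc) (κ ∘ suc) (colOp o₂ (colOp o₁ v)) x (x∉g ∘ suc) ⟩
  colOp o₂ (colOp o₁ v) x
    ≡⟨ updateAt-minimal x (suc (suc (g zero))) (colOp o₁ v) (x∉g zero) ⟩
  colOp o₁ v x                                                    ≡⟨ updateAt-minimal x (suc (suc (g zero))) v (x∉g zero) ⟩
  v x                                                             ∎
  where
  open ≡-Reasoning
  o₁ o₂ : ElemOp (2 ℕ.+ _)
  o₁ = addMul (suc (suc (g zero))) zero 1+i≢0 (proj₁ (κ zero))
  o₂ = addMul (suc (suc (g zero))) (suc zero) 2+i≢1 (proj₂ (κ zero))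

clearOps₂-cleared : ∀ {j m} (g : Fin j → Fin m) → Injective _≡_ _≡_ g → ∀ κ (v : Vector ℤ (2 ℕ.+ m)) k →
  colOp* (clearOps₂ g κ) v (suc (suc (g k))) ≡ (v (suc (suc (g k))) + proj₁ (κ k) * v zero) + proj₂ (κ k) * v (suc zero)
clearOps₂-cleared {suc j} g g-inj κ v zero = begin
  colOp* (clearOps₂ (g ∘ suc) (κ ∘ suc)) (colOp o₂ (colOp o₁ v)) c
    ≡⟨ clearOps₂-untouched (g ∘ suc) (κ ∘ suc) (colOp o₂ (colOp o₁ v)) c
         (λ k e → FinP.0≢1+n (g-inj (FinP.suc-injective (FinP.suc-injective e)))) ⟩
  colOp o₂ (colOp o₁ v) c                            ≡⟨ updateAt-updates c (colOp o₁ v) ⟩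
  colOp o₁ v c + proj₂ (κ zero) * v (suc zero)       ≡⟨ cong (_+ proj₂ (κ zero) * v (suc zero)) (updateAt-updates c v) ⟩
  (v c + proj₁ (κ zero) * v zero) + proj₂ (κ zero) * v (suc zero) ∎
  where
  open ≡-Reasoning
  c : Fin (2 ℕ.+ _)
  c = suc (suc (g zero))
  o₁ o₂ : ElemOp (2 ℕ.+ _)
  o₁ = addMul c zero 1+i≢0 (proj₁ (κ zero))
  o₂ = addMul c (suc zero) 2+i≢1 (proj₂ (κ zero))
clearOps₂-cleared {suc j} g g-inj κ v (suc k) = begin
  colOp* (clearOps₂ (g ∘ suc) (κ ∘ suc)) w c
    ≡⟨ clearOps₂-cleared (g ∘ suc) (FinP.suc-injective ∘ g-inj) (κ ∘ suc) w k ⟩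
  (w c + proj₁ (κ (suc k)) * v zero) + proj₂ (κ (suc k)) * v (suc zero)
    ≡⟨ cong (λ x → (x + proj₁ (κ (suc k)) * v zero) + proj₂ (κ (suc k)) * v (suc zero)) w-c ⟩
  (v c + proj₁ (κ (suc k)) * v zero) + proj₂ (κ (suc k)) * v (suc zero) ∎
  where
  open ≡-Reasoning
  c c₀ : Fin (2 ℕ.+ _)
  c = suc (suc (g (suc k)))
  c₀ = suc (suc (g zero))
  w : Vector ℤ (2 ℕ.+ _)
  w = colOp (addMul c₀ (suc zero) 2+i≢1 (proj₂ (κ zero))) (colOp (addMul c₀ zero 1+i≢0 (proj₁ (κ zero))) v)
  c≢c₀ : c ≢ c₀
  c≢c₀ e = 1+i≢0 (g-inj (FinP.suc-injective (FinP.suc-injective e)))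
  w-c : w c ≡ v c
  w-c = trans (updateAt-minimal c c₀ (colOp (addMul c₀ zero 1+i≢0 (proj₁ (κ zero))) v) c≢c₀) (updateAt-minimal c c₀ v c≢c₀)

sub₁ : ∀ {m} → Mat (suc m) → Mat m
sub₁ C i j = C (suc i) (suc j)

sub₂ : ∀ {m} → Mat (2 ℕ.+ m) → Mat m
sub₂ C i j = C (suc (suc i)) (suc (suc j))

BlockForm : ∀ {m} → Mat (2 ℕ.+ m) → Sym₂ → Set
BlockForm C (sym₂ a b c) = C zero zero ≡₄ a × C zero (suc zero) ≡₄ b × C (suc zero) (suc zero) ≡₄ c

split₁ : ∀ {m} {C : Mat (suc m)} {d} → Symmetric C → C zero zero ≡₄ d → (∀ j → C zero (suc j) ≡₄ + 0) →
  C ≈₄ d ⊕ sub₁ C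
split₁ sym-C C₀₀ row₀ zero    zero    = C₀₀
split₁ sym-C C₀₀ row₀ zero    (suc j) = row₀ j
split₁ sym-C C₀₀ row₀ (suc i) zero    = ≡₄-trans (≡⇒≡₄ (sym-C (suc i) zero)) (row₀ i)
split₁ sym-C C₀₀ row₀ (suc i) (suc j) = ≡₄-refl

split₂ : ∀ {m} {C : Mat (2 ℕ.+ m)} X → Symmetric C → BlockForm C X →
  (∀ j → C zero (suc (suc j)) ≡₄ + 0) → (∀ j → C (suc zero) (suc (suc j)) ≡₄ + 0) → C ≈₄ X ⊕₂ sub₂ C
split₂ {C = C} (sym₂ a b c) sym-C (C₀₀ , C₀₁ , C₁₁) row₀ row₁ = go
  where
  go : C ≈₄ sym₂ a b c ⊕₂ sub₂ C
  go zero                zero                = C₀₀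
  go zero                (suc zero)          = C₀₁
  go (suc zero)          zero                = ≡₄-trans (≡⇒≡₄ (sym-C (suc zero) zero)) C₀₁
  go (suc zero)          (suc zero)          = C₁₁
  go zero                (suc (suc j))       = row₀ j
  go (suc zero)          (suc (suc j))       = row₁ j
  go (suc (suc i))       zero                = ≡₄-trans (≡⇒≡₄ (sym-C (suc (suc i)) zero)) (row₀ i)
  go (suc (suc i))       (suc zero)          = ≡₄-trans (≡⇒≡₄ (sym-C (suc (suc i)) (suc zero))) (row₁ i)
  go (suc (suc i))       (suc (suc j))       = ≡₄-refl

Splits₁ : ∀ {m} → ℤ → Mat (suc m) → Set
Splits₁ d B = ∃[ L ] act* L B ≈₄ d ⊕ sub₁ (act* L B)

Splits₂ : ∀ {m} → Sym₂ → Mat (2 ℕ.+ m) → Set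
Splits₂ X B = ∃[ L ] act* L B ≈₄ X ⊕₂ sub₂ (act* L B)

Splits₁-act* : ∀ {m} {d} L {B : Mat (suc m)} → Splits₁ d (act* L B) → Splits₁ d B
Splits₁-act* {d = d} L {B} (L′ , split) = L ++ L′ , subst (λ C → C ≈₄ d ⊕ sub₁ C) (sym (act*-++ L L′ B)) split

Splits₂-act* : ∀ {m} {X} L {B : Mat (2 ℕ.+ m)} → Splits₂ X (act* L B) → Splits₂ X B
Splits₂-act* {X = X} L {B} (L′ , split) = L ++ L′ , subst (λ C → C ≈₄ X ⊕₂ sub₂ C) (sym (act*-++ L L′ B)) split

split-by-clearing₁ : ∀ {m} (C : Mat (suc m)) {d} → Symmetric C → C zero zero ≡₄ d → (κ : Fin m → ℤ) →
  (∀ k → C zero (suc k) + κ k * C zero zero ≡₄ + 0) → Splits₁ d C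
split-by-clearing₁ C {d} sym-C C₀₀ κ clears = L , split₁ (act*-symmetric L sym-C) pivot cleared
  where
  L : List (ElemOp (suc _))
  L = clearOps₁ (λ k → k) κ
  pivot : act* L C zero zero ≡₄ d
  pivot = ≡₄-trans (≡⇒≡₄ (trans (clearOps₁-row₀ (λ k → k) κ C zero)
                                (clearOps₁-untouched (λ k → k) κ (C zero) zero (λ k ())))) C₀₀
  cleared : ∀ k → act* L C zero (suc k) ≡₄ + 0
  cleared k = ≡₄-trans (≡⇒≡₄ (trans (clearOps₁-row₀ (λ k → k) κ C (suc k))
                                    (clearOps₁-cleared (λ k → k) (λ e → e) κ (C zero) k))) (clears k)

BlockForm-resp : ∀ {m} {C D : Mat (2 ℕ.+ m)} X →
  D zero zero ≡₄ C zero zero → D zero (suc zero) ≡₄ C zero (suc zero) → D (suc zero) (suc zero) ≡₄ C (suc zero) (suc zero) →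
  BlockForm C X → BlockForm D X
BlockForm-resp (sym₂ a b c) e₀₀ e₀₁ e₁₁ (C₀₀ , C₀₁ , C₁₁) = ≡₄-trans e₀₀ C₀₀ , ≡₄-trans e₀₁ C₀₁ , ≡₄-trans e₁₁ C₁₁

split-by-clearing₂ : ∀ {m} (C : Mat (2 ℕ.+ m)) X → Symmetric C → BlockForm C X → (κ : Fin m → ℤ × ℤ) →
  (∀ k → (C zero (suc (suc k)) + proj₁ (κ k) * C zero zero) + proj₂ (κ k) * C zero (suc zero) ≡₄ + 0
       × (C (suc zero) (suc (suc k)) + proj₁ (κ k) * C (suc zero) zero) + proj₂ (κ k) * C (suc zero) (suc zero) ≡₄ + 0) →
  Splits₂ X C
split-by-clearing₂ C X sym-C block κ clears =
  L , split₂ X (act*-symmetric L sym-C) (BlockForm-resp {C = C} {D = act* L C} X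
               (pivot zero zero (λ ()) (λ _ ())) (pivot zero (suc zero) (λ ()) (λ _ ())) (pivot (suc zero) (suc zero) (λ ()) (λ _ ())) block)
             (λ k → ≡₄-trans (≡⇒≡₄ (cleared zero (λ ()) k)) (proj₁ (clears k)))
             (λ k → ≡₄-trans (≡⇒≡₄ (cleared (suc zero) (λ ()) k)) (proj₂ (clears k)))
  where
  L : List (ElemOp (2 ℕ.+ _))
  L = clearOps₂ (λ k → k) κ
  pivot : ∀ r x → (∀ {c} → r ≢ suc (suc c)) → (∀ k → x ≢ suc (suc k)) → act* L C r x ≡₄ C r x
  pivot r x r≢col x≢col =
    ≡⇒≡₄ (trans (clearOps₂-row (λ k → k) κ C r r≢col x) (clearOps₂-untouched (λ k → k) κ (C r) x x≢col))
  cleared : ∀ r → (∀ {c} → r ≢ suc (suc c)) → ∀ k →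
    act* L C r (suc (suc k)) ≡ (C r (suc (suc k)) + proj₁ (κ k) * C r zero) + proj₂ (κ k) * C r (suc zero)
  cleared r r≢col k = trans (clearOps₂-row (λ k → k) κ C r r≢col (suc (suc k))) (clearOps₂-cleared (λ k → k) (λ e → e) κ (C r) k)

unimodular-clears-row₀ : ∀ {d} → d * d ≡₄ + 0 → ∀ {x₀₀ x₀₁} v₁ v₂ → x₀₀ ≡₄ d → x₀₁ ≡₄ + 1 →
  (v₁ + (d * v₁ - v₂) * x₀₀) + (d * v₂ - v₁) * x₀₁ ≡₄ + 0
unimodular-clears-row₀ {d} d²≡0 v₁ v₂ x₀₀≡d x₀₁≡1 = begin
  (v₁ + (d * v₁ - v₂) * _) + (d * v₂ - v₁) * _
    ≈⟨ combine-≡₄ (d * v₂ - v₁) (combine-≡₄ (d * v₁ - v₂) (≡₄-refl {v₁}) x₀₀≡d) x₀₁≡1 ⟩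
  (v₁ + (d * v₁ - v₂) * d) + (d * v₂ - v₁) * + 1   ≡⟨ identity d v₁ v₂ ⟩
  d * d * v₁                                       ≈⟨ *-cong₄ d²≡0 ≡₄-refl ⟩
  + 0                                              ∎
  where
  open ≡₄-Reasoning
  identity : ∀ d v₁ v₂ → (v₁ + (d * v₁ - v₂) * d) + (d * v₂ - v₁) * + 1 ≡ d * d * v₁
  identity = solve-∀

unimodular-clears-row₁ : ∀ {d} → d * d ≡₄ + 0 → ∀ {x₁₀ x₁₁} v₁ v₂ → x₁₀ ≡₄ + 1 → x₁₁ ≡₄ d →
  (v₂ + (d * v₁ - v₂) * x₁₀) + (d * v₂ - v₁) * x₁₁ ≡₄ + 0
unimodular-clears-row₁ {d} d²≡0 v₁ v₂ x₁₀≡1 x₁₁≡d = begin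
  (v₂ + (d * v₁ - v₂) * _) + (d * v₂ - v₁) * _
    ≈⟨ combine-≡₄ (d * v₂ - v₁) (combine-≡₄ (d * v₁ - v₂) (≡₄-refl {v₂}) x₁₀≡1) x₁₁≡d ⟩
  (v₂ + (d * v₁ - v₂) * + 1) + (d * v₂ - v₁) * d   ≡⟨ identity d v₁ v₂ ⟩
  d * d * v₂                                       ≈⟨ *-cong₄ d²≡0 ≡₄-refl ⟩
  + 0                                              ∎
  where
  open ≡₄-Reasoning
  identity : ∀ d v₁ v₂ → (v₂ + (d * v₁ - v₂) * + 1) + (d * v₂ - v₁) * d ≡ d * d * v₂
  identity = solve-∀

halving-clears-row₀ : ∀ {x₀₀ x₀₁} v₁ v₂ → Even v₁ → x₀₀ ≡₄ + 0 → x₀₁ ≡₄ + 2 →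
  (v₁ + (- half v₂) * x₀₀) + (- half v₁) * x₀₁ ≡₄ + 0
halving-clears-row₀ v₁ v₂ ev₁ x₀₀≡0 x₀₁≡2 = begin
  (v₁ + (- half v₂) * _) + (- half v₁) * _
    ≈⟨ combine-≡₄ (- half v₁) (combine-≡₄ (- half v₂) (≡₄-refl {v₁}) x₀₀≡0) x₀₁≡2 ⟩
  (v₁ + (- half v₂) * + 0) + (- half v₁) * + 2
    ≡⟨ cong (λ v → (v + (- half v₂) * + 0) + (- half v₁) * + 2) (even⇒half*2 ev₁) ⟩
  (half v₁ * + 2 + (- half v₂) * + 0) + (- half v₁) * + 2 ≡⟨ cancel (half v₁) (- half v₂) ⟩
  + 0                                                     ∎
  where
  open ≡₄-Reasoning
  cancel : ∀ h₁ α → (h₁ * + 2 + α * + 0) + (- h₁) * + 2 ≡ + 0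
  cancel = solve-∀

halving-clears-row₁ : ∀ {x₁₀ x₁₁} v₁ v₂ → Even v₂ → x₁₀ ≡₄ + 2 → x₁₁ ≡₄ + 0 →
  (v₂ + (- half v₂) * x₁₀) + (- half v₁) * x₁₁ ≡₄ + 0
halving-clears-row₁ v₁ v₂ ev₂ x₁₀≡2 x₁₁≡0 = begin
  (v₂ + (- half v₂) * _) + (- half v₁) * _
    ≈⟨ combine-≡₄ (- half v₁) (combine-≡₄ (- half v₂) (≡₄-refl {v₂}) x₁₀≡2) x₁₁≡0 ⟩
  (v₂ + (- half v₂) * + 2) + (- half v₁) * + 0
    ≡⟨ cong (λ v → (v + (- half v₂) * + 2) + (- half v₁) * + 0) (even⇒half*2 ev₂) ⟩
  (half v₂ * + 2 + (- half v₂) * + 2) + (- half v₁) * + 0 ≡⟨ cancel (half v₂) (- half v₁) ⟩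
  + 0                                                     ∎
  where
  open ≡₄-Reasoning
  cancel : ∀ h₂ γ → (h₂ * + 2 + (- h₂) * + 2) + γ * + 0 ≡ + 0
  cancel = solve-∀

halving-clears₁ : ∀ {x} v → Even v → x ≡₄ + 2 → v + (- half v) * x ≡₄ + 0
halving-clears₁ v ev x≡2 = begin
  v + (- half v) * _               ≈⟨ combine-≡₄ (- half v) (≡₄-refl {v}) x≡2 ⟩
  v + (- half v) * + 2             ≡⟨ cong (λ w → w + (- half v) * + 2) (even⇒half*2 ev) ⟩
  half v * + 2 + (- half v) * + 2  ≡⟨ cancel (half v) ⟩
  + 0                              ∎
  where
  open ≡₄-Reasoning
  cancel : ∀ h → h * + 2 + (- h) * + 2 ≡ + 0
  cancel = solve-∀

pivotOps : ∀ {m} → Fin (2 ℕ.+ m) → Fin (2 ℕ.+ m) → List (ElemOp (2 ℕ.+ m))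
pivotOps i j = swap zero i ∷ swap (suc zero) (transposition i zero j) ∷ []

pivot-block : ∀ {m} (B : Mat (2 ℕ.+ m)) {i j} → i ≢ j →
  act* (pivotOps i j) B zero zero ≡ B i i ×
  act* (pivotOps i j) B zero (suc zero) ≡ B i j ×
  act* (pivotOps i j) B (suc zero) (suc zero) ≡ B j j
pivot-block B {i} {j} i≢j = cong₂ B τσ₀ τσ₀ , cong₂ B τσ₀ τσ₁ , cong₂ B τσ₁ τσ₁
  where
  j′ : Fin (2 ℕ.+ _)
  j′ = transposition i zero j
  τj′ : transposition zero i j′ ≡ j
  τj′ = transpose-inverse zero i
  0≢j′ : zero ≢ j′
  0≢j′ 0≡j′ = i≢j (trans (sym (transposition-matchˡ zero i)) (trans (cong (transposition zero i) 0≡j′) τj′))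
  τσ₀ : transposition zero i (transposition (suc zero) j′ zero) ≡ i
  τσ₀ = trans (cong (transposition zero i) (transposition-other {a = suc zero} {b = j′} (λ ()) 0≢j′)) (transposition-matchˡ zero i)
  τσ₁ : transposition zero i (transposition (suc zero) j′ (suc zero)) ≡ j
  τσ₁ = trans (cong (transposition zero i) (transposition-matchˡ (suc zero) j′)) τj′

-- Operations on the indices 0 and 1 produce a top-left block that depends only on the old one;
-- putting literals into that block lets its new residues be computed by normalisation.
withBlock : ∀ {m} → Sym₂ → Mat (2 ℕ.+ m) → Mat (2 ℕ.+ m)
withBlock (sym₂ a b c) B zero          zero          = a
withBlock (sym₂ a b c) B zero          (suc zero)    = b
withBlock (sym₂ a b c) B (suc zero)    zero          = b
withBlock (sym₂ a b c) B (suc zero)    (suc zero)    = c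
withBlock (sym₂ a b c) B zero          (suc (suc j)) = B zero (suc (suc j))
withBlock (sym₂ a b c) B (suc zero)    (suc (suc j)) = B (suc zero) (suc (suc j))
withBlock (sym₂ a b c) B (suc (suc i)) j             = B (suc (suc i)) j

≈₄-withBlock : ∀ {m} {B : Mat (2 ℕ.+ m)} X → Symmetric B → BlockForm B X → B ≈₄ withBlock X B
≈₄-withBlock (sym₂ a b c) sym-B (B₀₀ , B₀₁ , B₁₁) zero          zero          = B₀₀
≈₄-withBlock (sym₂ a b c) sym-B (B₀₀ , B₀₁ , B₁₁) zero          (suc zero)    = B₀₁
≈₄-withBlock (sym₂ a b c) sym-B (B₀₀ , B₀₁ , B₁₁) (suc zero)    zero          = ≡₄-trans (≡⇒≡₄ (sym-B (suc zero) zero)) B₀₁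
≈₄-withBlock (sym₂ a b c) sym-B (B₀₀ , B₀₁ , B₁₁) (suc zero)    (suc zero)    = B₁₁
≈₄-withBlock (sym₂ a b c) sym-B (B₀₀ , B₀₁ , B₁₁) zero          (suc (suc j)) = ≡₄-refl
≈₄-withBlock (sym₂ a b c) sym-B (B₀₀ , B₀₁ , B₁₁) (suc zero)    (suc (suc j)) = ≡₄-refl
≈₄-withBlock (sym₂ a b c) sym-B (B₀₀ , B₀₁ , B₁₁) (suc (suc i)) j             = ≡₄-refl

data UnimodularBlock : Sym₂ → Set where
  E-block : UnimodularBlock E
  H-block : UnimodularBlock H

normalise-unimodular : ∀ {m} (B : Mat (2 ℕ.+ m)) → Symmetric B →
  Even (B zero zero) → ¬ Even (B zero (suc zero)) → Even (B (suc zero) (suc zero)) →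
  ∃[ X ] UnimodularBlock X × ∃[ L ] BlockForm (act* L B) X
normalise-unimodular B sym-B e₀₀ o₀₁ e₁₁ = by-residues (even-residue e₀₀) (odd-residue o₀₁) (even-residue e₁₁)
  where
  Result : Set
  Result = ∃[ X ] UnimodularBlock X × ∃[ L ] BlockForm (act* L B) X
  add₀₁ add₁₀ : ElemOp (2 ℕ.+ _)
  add₀₁ = addMul zero (suc zero) FinP.0≢1+n (+ 1)
  add₁₀ = addMul (suc zero) zero 1+i≢0 (+ 1)
  via : ∀ {R} X → UnimodularBlock X → ∀ L → BlockForm B R → BlockForm (act* L (withBlock R B)) X → Result
  via {R} X u L block computed = X , u , L ,
    BlockForm-resp {C = act* L (withBlock R B)} {D = act* L B} X (e zero zero) (e zero (suc zero)) (e (suc zero) (suc zero)) computed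
    where
    e : act* L B ≈₄ act* L (withBlock R B)
    e = act*-≈₄ L (≈₄-withBlock R sym-B block)
  by-residues : B zero zero ≡₄ + 0 ⊎ B zero zero ≡₄ + 2 → B zero (suc zero) ≡₄ + 1 ⊎ B zero (suc zero) ≡₄ + 3 →
    B (suc zero) (suc zero) ≡₄ + 0 ⊎ B (suc zero) (suc zero) ≡₄ + 2 → Result
  by-residues (inj₁ a) (inj₁ b) (inj₁ c) = via H H-block []                            (a , b , c) (mk≡₄ refl , mk≡₄ refl , mk≡₄ refl)
  by-residues (inj₁ a) (inj₁ b) (inj₂ c) = via H H-block (add₁₀ ∷ [])                  (a , b , c) (mk≡₄ refl , mk≡₄ refl , mk≡₄ refl)
  by-residues (inj₁ a) (inj₂ b) (inj₁ c) = via H H-block (add₀₁ ∷ add₁₀ ∷ add₀₁ ∷ [])  (a , b , c) (mk≡₄ refl , mk≡₄ refl , mk≡₄ refl)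
  by-residues (inj₁ a) (inj₂ b) (inj₂ c) = via H H-block (add₀₁ ∷ add₁₀ ∷ [])          (a , b , c) (mk≡₄ refl , mk≡₄ refl , mk≡₄ refl)
  by-residues (inj₂ a) (inj₁ b) (inj₁ c) = via H H-block (add₀₁ ∷ [])                  (a , b , c) (mk≡₄ refl , mk≡₄ refl , mk≡₄ refl)
  by-residues (inj₂ a) (inj₁ b) (inj₂ c) = via E E-block []                            (a , b , c) (mk≡₄ refl , mk≡₄ refl , mk≡₄ refl)
  by-residues (inj₂ a) (inj₂ b) (inj₁ c) = via H H-block (add₁₀ ∷ add₀₁ ∷ [])          (a , b , c) (mk≡₄ refl , mk≡₄ refl , mk≡₄ refl)
  by-residues (inj₂ a) (inj₂ b) (inj₂ c) = via E E-block (add₀₁ ∷ [])                  (a , b , c) (mk≡₄ refl , mk≡₄ refl , mk≡₄ refl)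

-- (α, γ) = −X⁻¹ (v₁, v₂) for X = [[d,1],[1,d]], whose inverse mod 4 is −[[d,−1],[−1,d]] as d² ≡ 0.
clear-unimodular-block : ∀ {m} d → d * d ≡₄ + 0 → (C : Mat (2 ℕ.+ m)) → Symmetric C →
  BlockForm C (sym₂ d (+ 1) d) → Splits₂ (sym₂ d (+ 1) d) C
clear-unimodular-block d d²≡0 C sym-C (C₀₀ , C₀₁ , C₁₁) =
  split-by-clearing₂ C (sym₂ d (+ 1) d) sym-C (C₀₀ , C₀₁ , C₁₁) κ clears
  where
  v₁ v₂ : Fin _ → ℤ
  v₁ k = C zero (suc (suc k))
  v₂ k = C (suc zero) (suc (suc k))
  κ : Fin _ → ℤ × ℤ
  κ k = d * v₁ k - v₂ k , d * v₂ k - v₁ k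
  C₁₀ : C (suc zero) zero ≡₄ + 1
  C₁₀ = ≡₄-trans (≡⇒≡₄ (sym-C (suc zero) zero)) C₀₁
  clears : ∀ k → (C zero (suc (suc k)) + proj₁ (κ k) * C zero zero) + proj₂ (κ k) * C zero (suc zero) ≡₄ + 0
                × (C (suc zero) (suc (suc k)) + proj₁ (κ k) * C (suc zero) zero) + proj₂ (κ k) * C (suc zero) (suc zero) ≡₄ + 0
  clears k = unimodular-clears-row₀ d²≡0 (v₁ k) (v₂ k) C₀₀ C₀₁ , unimodular-clears-row₁ d²≡0 (v₁ k) (v₂ k) C₁₀ C₁₁

clear-unimodular : ∀ {m} {X} → UnimodularBlock X → (C : Mat (2 ℕ.+ m)) → Symmetric C → BlockForm C X → Splits₂ X C
clear-unimodular E-block = clear-unimodular-block (+ 2) (mk≡₄ refl)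
clear-unimodular H-block = clear-unimodular-block (+ 0) (mk≡₄ refl)

unimodular-split : ∀ {m} (B : Mat (2 ℕ.+ m)) → Symmetric B → EvenDiag B → ∀ {i j} → ¬ Even (B i j) →
  ∃[ X ] UnimodularBlock X × Splits₂ X B
unimodular-split B sym-B ev {i} {j} odd = split (normalise-unimodular B₁ sym-B₁ e₀₀ o₀₁ e₁₁)
  where
  i≢j : i ≢ j
  i≢j refl = odd (ev i)
  B₁ : Mat (2 ℕ.+ _)
  B₁ = act* (pivotOps i j) B
  sym-B₁ : Symmetric B₁
  sym-B₁ = act*-symmetric (pivotOps i j) sym-B
  e₀₀ : Even (B₁ zero zero)
  e₀₀ = subst Even (sym (proj₁ (pivot-block B i≢j))) (ev i)
  o₀₁ : ¬ Even (B₁ zero (suc zero))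
  o₀₁ = odd ∘ subst Even (proj₁ (proj₂ (pivot-block B i≢j)))
  e₁₁ : Even (B₁ (suc zero) (suc zero))
  e₁₁ = subst Even (sym (proj₂ (proj₂ (pivot-block B i≢j)))) (ev j)
  split : ∃[ X ] UnimodularBlock X × ∃[ L ] BlockForm (act* L B₁) X → ∃[ X ] UnimodularBlock X × Splits₂ X B
  split (X , u , L , block) = X , u , Splits₂-act* (pivotOps i j) (Splits₂-act* L
    (clear-unimodular u (act* L B₁) (act*-symmetric L sym-B₁) block))

T-split : ∀ {m} (B : Mat (2 ℕ.+ m)) → Symmetric B → AllEven B → (∀ k → ¬ B k k ≡₄ + 2) →
  ∀ {i j} → B i j ≡₄ + 2 → Splits₂ T B
T-split B sym-B ev no-2 {i} {j} Bij≡2 = Splits₂-act* (pivotOps i j)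
  (split-by-clearing₂ C T sym-C (C₀₀ , C₀₁ , C₁₁) κ clears)
  where
  i≢j : i ≢ j
  i≢j refl = no-2 i Bij≡2
  diagonal-zero : ∀ k → B k k ≡₄ + 0
  diagonal-zero k with even-residue (ev k k)
  ... | inj₁ Bkk≡0 = Bkk≡0
  ... | inj₂ Bkk≡2 = contradiction Bkk≡2 (no-2 k)
  C : Mat (2 ℕ.+ _)
  C = act* (pivotOps i j) B
  sym-C : Symmetric C
  sym-C = act*-symmetric (pivotOps i j) sym-B
  C₀₀ : C zero zero ≡₄ + 0
  C₀₀ = ≡₄-trans (≡⇒≡₄ (proj₁ (pivot-block B i≢j))) (diagonal-zero i)
  C₀₁ : C zero (suc zero) ≡₄ + 2
  C₀₁ = ≡₄-trans (≡⇒≡₄ (proj₁ (proj₂ (pivot-block B i≢j)))) Bij≡2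
  C₁₁ : C (suc zero) (suc zero) ≡₄ + 0
  C₁₁ = ≡₄-trans (≡⇒≡₄ (proj₂ (proj₂ (pivot-block B i≢j)))) (diagonal-zero j)
  C₁₀ : C (suc zero) zero ≡₄ + 2
  C₁₀ = ≡₄-trans (≡⇒≡₄ (sym-C (suc zero) zero)) C₀₁
  v₁ v₂ : Fin _ → ℤ
  v₁ k = C zero (suc (suc k))
  v₂ k = C (suc zero) (suc (suc k))
  κ : Fin _ → ℤ × ℤ
  κ k = - half (v₂ k) , - half (v₁ k)
  ev-C : AllEven C
  ev-C = act*-allEven (pivotOps i j) ev
  clears : ∀ k → (C zero (suc (suc k)) + proj₁ (κ k) * C zero zero) + proj₂ (κ k) * C zero (suc zero) ≡₄ + 0
                × (C (suc zero) (suc (suc k)) + proj₁ (κ k) * C (suc zero) zero) + proj₂ (κ k) * C (suc zero) (suc zero) ≡₄ + 0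
  clears k = halving-clears-row₀ (v₁ k) (v₂ k) (ev-C zero (suc (suc k))) C₀₀ C₀₁
           , halving-clears-row₁ (v₁ k) (v₂ k) (ev-C (suc zero) (suc (suc k))) C₁₀ C₁₁

two-split : ∀ {m} (B : Mat (suc m)) → Symmetric B → AllEven B → ∀ {i} → B i i ≡₄ + 2 → Splits₁ (+ 2) B
two-split B sym-B ev {i} Bii≡2 = Splits₁-act* (swap zero i ∷ [])
  (split-by-clearing₁ C sym-C C₀₀ (λ k → - half (C zero (suc k)))
    (λ k → halving-clears₁ (C zero (suc k)) (act*-allEven (swap zero i ∷ []) ev zero (suc k)) C₀₀))
  where
  C : Mat (suc _)
  C = act (swap zero i) B
  sym-C : Symmetric C
  sym-C = act-symmetric (swap zero i) sym-B
  C₀₀ : C zero zero ≡₄ + 2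
  C₀₀ = ≡₄-trans (≡⇒≡₄ (cong₂ B (transposition-matchˡ zero i) (transposition-matchˡ zero i))) Bii≡2

-- Reduction to the normal form

X⊕-NormalForm : ∀ {k} {X} {R : Mat k} → UnimodularBlock X → NormalForm R → NormalForm (X ⊕₂ R)
X⊕-NormalForm E-block = E⊕-NormalForm
X⊕-NormalForm H-block = H⊕-NormalForm

NormalForm-by-unimodular : ∀ {m} (B : Mat (2 ℕ.+ m)) → Symmetric B → EvenDiag B →
  ∃[ X ] UnimodularBlock X × Splits₂ X B →
  (∀ (R : Mat m) → Symmetric R → EvenDiag R → NormalForm R) → NormalForm B
NormalForm-by-unimodular B sym-B ev (X , u , L , split) normalise =
  NormalForm-⇝ (L , split) (X⊕-NormalForm u (normalise (sub₂ C) (λ i j → sym-C (suc (suc i)) (suc (suc j))) (λ i → ev-C (suc (suc i)))))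
  where
  C : Mat (2 ℕ.+ _)
  C = act* L B
  sym-C : Symmetric C
  sym-C = act*-symmetric L sym-B
  ev-C : EvenDiag C
  ev-C = act*-evenDiag L sym-B ev

EvenNormalForm-by-two : ∀ {m} (B : Mat (suc m)) → Symmetric B → AllEven B → Splits₁ (+ 2) B →
  (∀ (R : Mat m) → Symmetric R → AllEven R → EvenNormalForm R) → EvenNormalForm B
EvenNormalForm-by-two B sym-B ev (L , split) normalise =
  EvenNormalForm-⇝ (L , split) (2⊕-EvenNormalForm (normalise (sub₁ C) (λ i j → sym-C (suc i) (suc j)) (λ i j → ev-C (suc i) (suc j))))
  where
  C : Mat (suc _)
  C = act* L B
  sym-C : Symmetric C
  sym-C = act*-symmetric L sym-B
  ev-C : AllEven C
  ev-C = act*-allEven L ev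

EvenNormalForm-by-T : ∀ {m} (B : Mat (2 ℕ.+ m)) → Symmetric B → AllEven B → Splits₂ T B →
  (∀ (R : Mat m) → Symmetric R → AllEven R → EvenNormalForm R) → EvenNormalForm B
EvenNormalForm-by-T B sym-B ev (L , split) normalise =
  EvenNormalForm-⇝ (L , split) (T⊕-EvenNormalForm
    (normalise (sub₂ C) (λ i j → sym-C (suc (suc i)) (suc (suc j))) (λ i j → ev-C (suc (suc i)) (suc (suc j)))))
  where
  C : Mat (2 ℕ.+ _)
  C = act* L B
  sym-C : Symmetric C
  sym-C = act*-symmetric L sym-B
  ev-C : AllEven C
  ev-C = act*-allEven L ev

no-two⇒zero : ∀ {n} {B : Mat n} → AllEven B → (∀ i j → ¬ B i j ≡₄ + 2) → B ≈₄ 0ₘ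
no-two⇒zero ev no-2 i j with even-residue (ev i j)
... | inj₁ Bij≡0 = Bij≡0
... | inj₂ Bij≡2 = contradiction Bij≡2 (no-2 i j)

EvenNormalForm-step : ∀ {m} (B : Mat (2 ℕ.+ m)) → Symmetric B → AllEven B →
  (∀ (R : Mat (suc m)) → Symmetric R → AllEven R → EvenNormalForm R) →
  (∀ (R : Mat m) → Symmetric R → AllEven R → EvenNormalForm R) → EvenNormalForm B
EvenNormalForm-step B sym-B ev normalise₁ normalise₂ with FinP.any? (λ i → B i i ≟₄ + 2)
... | yes (i , Bii≡2) = EvenNormalForm-by-two B sym-B ev (two-split B sym-B ev Bii≡2) normalise₁
... | no no-diagonal-2 with FinP.any? (λ i → FinP.any? (λ j → B i j ≟₄ + 2))
...   | yes (i , j , Bij≡2) =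
  EvenNormalForm-by-T B sym-B ev (T-split B sym-B ev (λ k Bkk≡2 → no-diagonal-2 (k , Bkk≡2)) Bij≡2) normalise₂
...   | no no-2 = zero-EvenNormalForm (no-two⇒zero ev (λ i j Bij≡2 → no-2 (i , j , Bij≡2)))

toEvenNormalForm : ∀ {n} (B : Mat n) → Symmetric B → AllEven B → EvenNormalForm B
toEvenNormalForm {zero} B _ _ = zero-EvenNormalForm (λ ())
toEvenNormalForm {suc zero} B sym-B ev with B zero zero ≟₄ + 2
... | yes B₀₀≡2 = evenNormalForm 0 1 0 refl (≈₄⇒⇝ λ { zero zero → B₀₀≡2 })
... | no B₀₀≢2  = zero-EvenNormalForm (no-two⇒zero ev λ { zero zero → B₀₀≢2 })
toEvenNormalForm {suc (suc m)} B sym-B ev = EvenNormalForm-step B sym-B ev toEvenNormalForm toEvenNormalForm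

toNormalForm : ∀ {n} (B : Mat n) → Symmetric B → EvenDiag B → NormalForm B
toNormalForm {zero} B sym-B _ = EvenNormalForm⇒NormalForm (toEvenNormalForm B sym-B (λ ()))
toNormalForm {suc zero} B sym-B ev = EvenNormalForm⇒NormalForm (toEvenNormalForm B sym-B (λ { zero zero → ev zero }))
toNormalForm {suc (suc m)} B sym-B ev with FinP.any? (λ i → FinP.any? (λ j → Dec.¬? (+ 2 ℤDiv.∣? B i j)))
... | yes (i , j , odd) = NormalForm-by-unimodular B sym-B ev (unimodular-split B sym-B ev odd) toNormalForm
... | no no-odd = EvenNormalForm⇒NormalForm (toEvenNormalForm B sym-B all-even)
  where
  all-even : AllEven B
  all-even i j = Dec.decidable-stable (+ 2 ℤDiv.∣? B i j) (λ odd → no-odd (i , j , odd))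

theorem1p1 : (n : ℕ) (A : Mat n) → Symmetric A → EvenDiagonal A →
    ∃[ P ] ∃[ r ] ∃[ s ] ∃[ t ] ∃[ p ] ∃[ m ]
    ((det P ≡ + 1 ⊎ det P ≡ - (+ 1))
    × (2 ℕ.* r ℕ.+ 2 ℕ.* s ℕ.+ 2 ℕ.* t ℕ.+ p ℕ.+ m ≡ n)
    × (∀ i j → mod4 ((transpose P ⊗ A) ⊗ P) i j ≡ N r s t p m i j))
theorem1p1 n A sym-A even-A with toNormalForm A sym-A (λ i → ℤDiv.∣ᵤ⇒∣ (even-A i))
... | normalForm r s t p m size (L , A⇝N) =
  1ₘ ◁* L , r , s , t , p , m , unimodular-◁* (inj₁ (det-1ₘ {n})) L , size , entries
  where
  entries : ∀ i j → mod4 (Gram A (1ₘ ◁* L)) i j ≡ N r s t p m i j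
  entries i j = ≡₄-residue-value (begin
    Gram A (1ₘ ◁* L) i j   ≡⟨ Gram-◁* A 1ₘ L i j ⟩
    act* L (Gram A 1ₘ) i j ≡⟨ act*-cong L (Gram-1ₘ A) i j ⟩
    act* L A i j           ≈⟨ A⇝N i j ⟩
    NF r s t p m i j       ∎) (N<4 r s t p m i j)
    where open ≡₄-Reasoning
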